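{- (1) $(\mathrm{PF},\mathrm{TA},\mathrm{MinSat})\preceq_{ptime}(\exists\mathrm{PF},\mathrm{TA},\mathrm{FMinSat})$. (2) $(\exists\mathrm{PF},\mathrm{TA},\mathrm{FSat})\preceq_{ptime}(\exists\mathrm{PF},\mathrm{TA},\mathrm{FMinSat})$.
   Context: A logic system is a tuple $(\Gamma,\Delta,T,S,R)$ (written $(T,S,R)$) with $\Gamma,\Delta$ nonempty finite disjoint alphabets, $T\subseteq\Gamma^*$, $S\subseteq\Delta^*$ polynomial-time decidable, $R\subseteq\Gamma^*\times\Delta^*$; $\mathrm{Mod}_R(t)=\{w\in S: R(t,w)\}$. $(T_1,S_1,R_1)\preceq_{ptime}(T_2,S_2,R_2)$ means: there are polynomials $p,q$, a function $f:T_1\to T_2$ computable in time $p(|t|)$ and a map $g:T_1\times S_1\to S_2$ computable in time $q(|(t,w)|)$ such that for each $t\in T_1$, $v\mapsto g(t,v)$ is a bijection from $\mathrm{Mod}_{R_1}(t)$ onto $\mathrm{Mod}_{R_2}(f(t))$. Propositional variables $x_1,x_2,\dots$; $\mathrm{TA}=\{0,1\}^*$, where $w$ of length $n$ encodes the assignment with $x_i$ true iff the $i$-th bit is $1$ (equivalently the set of true variables). $\mathrm{PF}$: encodings of propositional formulas. $\mathrm{MinSat}(t,w)$: $w$ encodes a minimal model of the propositional formula $t$, i.e. a model $M$ (as a set of true atoms) such that no proper subset of $M$ is a model. $\exists\mathrm{PF}$: encodings of formulas $\Phi=\exists y_1\cdots\exists y_m\varphi$, $\varphi$ propositional, free variables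 allowed; a model of $\Phi$ is a truth assignment $v$ on its free variables with $\Phi[v]$ true. $\mathrm{FSat}(\Phi,w)$: $w$ encodes a model of $\Phi$. $\mathrm{FMinSat}(\Phi,w)$: $w$ encodes a minimal model of $\Phi$, i.e. a model $M$ (as a set of true free variables) such that no proper subset of $M$ is a model of $\Phi$. -}

module Defs where

open import Data.Nat using (ℕ; zero; suc; _+_; _*_; _≤_; _⊔_)
open import Data.Fin using (Fin; zero; suc; _↑ˡ_; _↑ʳ_; toℕ)
import Data.Fin as F
open import Data.List using (List; []; _∷_; _++_; map; length; replicate; concatMap; upTo)
open import Data.List.Relation.Binary.Pointwise using (Pointwise)
open import Data.Maybe using (Maybe; just; nothing)
import Data.Maybe as Maybe
open import Data.Bool using (Bool; true; false; _∧_; _∨_; not)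
open import Data.Sum using (_⊎_; inj₁; inj₂; [_,_])
open import Data.Product using (Σ; _×_; _,_; ∃)
open import Data.Unit using (⊤)
open import Relation.Binary.PropositionalEquality using (_≡_; _≢_)
open import Relation.Nullary using (¬_)

Word : ℕ → Set
Word a = List (Fin a)

-- Polynomials with natural coefficients (c₀ ∷ c₁ ∷ … = c₀ + c₁ x + …)

Poly : Set
Poly = List ℕ

evalPoly : Poly → ℕ → ℕ
evalPoly []       x = 0
evalPoly (c ∷ cs) x = c + x * evalPoly cs x

-- Deterministic single-tape Turing machines with input alphabet Fin a,
-- output alphabet Fin b, e extra work symbols and a blank (nothing).

data Move : Set where
  left right stay : Move

Cell : ℕ → ℕ → ℕ → Set
Cell a b e = Maybe (Fin a ⊎ (Fin b ⊎ Fin e))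

record TM (a b : ℕ) : Set where
  field
    e     : ℕ
    s     : ℕ
    start : Fin s
    halt  : Fin s → Bool
    δ     : Fin s → Cell a b e → Fin s × Cell a b e × Move

module Run {a b : ℕ} (M : TM a b) where
  open TM M

  -- state, cells left of the head (nearest first), head cell, cells right
  -- of the head (nearest first); all other cells are blank
  record Config : Set where
    constructor ⟨_,_,_,_⟩
    field
      st  : Fin s
      lt  : List (Cell a b e)
      hd  : Cell a b e
      rt  : List (Cell a b e)

  init : Word a → Config
  init []      = ⟨ start , [] , nothing , [] ⟩
  init (x ∷ w) = ⟨ start , [] , just (inj₁ x) , map (λ y → just (inj₁ y)) w ⟩

  move : Move → List (Cell a b e) → Cell a b e → List (Cell a b e) → Fin s → Config
  move left  []       c r q = ⟨ q , [] , nothing , c ∷ r ⟩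
  move left  (l ∷ ls) c r q = ⟨ q , ls , l , c ∷ r ⟩
  move right l c []       q = ⟨ q , c ∷ l , nothing , [] ⟩
  move right l c (x ∷ rs) q = ⟨ q , c ∷ l , x , rs ⟩
  move stay  l c r        q = ⟨ q , l , c , r ⟩

  stepWith : Bool → Config → Config
  stepWith true  k = k
  stepWith false ⟨ q , l , c , r ⟩ with δ q c
  ... | q′ , c′ , m = move m l c′ r q′

  step : Config → Config
  step k = stepWith (halt (Config.st k)) k

  run : ℕ → Config → Config
  run zero    k = k
  run (suc n) k = run n (step k)

  -- output: the maximal block of non-blank cells starting at the head,
  -- which must consist of output symbols
  readOut : List (Cell a b e) → Maybe (Word b)
  readOut []                          = just []
  readOut (nothing ∷ _)               = just []
  readOut (just (inj₁ _) ∷ _)         = nothing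
  readOut (just (inj₂ (inj₁ y)) ∷ cs) = Maybe.map (y ∷_) (readOut cs)
  readOut (just (inj₂ (inj₂ _)) ∷ _)  = nothing

  HaltsWithin : ℕ → Word a → Word b → Set
  HaltsWithin n w v = Σ ℕ λ k → k ≤ n ×
    (let c = run k (init w) in
      (halt (Config.st c) ≡ true) × (readOut (Config.hd c ∷ Config.rt c) ≡ just v))

ComputableInTime : {a b : ℕ} (D : Word a → Set) (f : (w : Word a) → D w → Word b)
                   (p : Poly) → Set
ComputableInTime {a} {b} D f p =
  Σ (TM a b) λ M → (w : Word a) (h : D w) →
    Run.HaltsWithin M (evalPoly p (length w)) w (f w h)

-- encoding of a pair (t , w) ∈ Γ* × Δ* as a word over Γ ⊎ Δ ⊎ {separator}
pairEnc : {a d : ℕ} → Word a → Word d → Word (suc (a + d))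
pairEnc {a} {d} t w =
  map (λ x → suc (x ↑ˡ d)) t ++ (zero ∷ map (λ y → suc (a ↑ʳ y)) w)

record LogicSystem : Set₁ where
  field
    a d : ℕ
    T   : Word a → Set
    S   : Word d → Set
    R   : Word a → Word d → Set

_≼ptime_ : LogicSystem → LogicSystem → Set
L₁ ≼ptime L₂ =
  Σ Poly λ p → Σ Poly λ q →
  Σ ((t : Word a₁) → T₁ t → Word a₂) λ f →
  Σ ((t : Word a₁) → T₁ t → (w : Word d₁) → S₁ w → Word d₂) λ g →
    ((t : Word a₁) (h : T₁ t) → T₂ (f t h)) ×
    ComputableInTime T₁ f p ×
    (Σ (TM (suc (a₁ + d₁)) d₂) λ M →
       (t : Word a₁) (h : T₁ t) (w : Word d₁) (sw : S₁ w) →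
         Run.HaltsWithin M (evalPoly q (length (pairEnc t w))) (pairEnc t w) (g t h w sw)) ×
    -- for each t ∈ T₁, v ↦ g(t,v) is a bijection Mod_{R₁}(t) → Mod_{R₂}(f t)
    ((t : Word a₁) (h : T₁ t) →
       ((v : Word d₁) (sv : S₁ v) → R₁ t v → S₂ (g t h v sv) × R₂ (f t h) (g t h v sv)) ×
       ((v v′ : Word d₁) (sv : S₁ v) (sv′ : S₁ v′) → R₁ t v → R₁ t v′ →
          g t h v sv ≡ g t h v′ sv′ → v ≡ v′) ×
       ((u : Word d₂) → S₂ u → R₂ (f t h) u →
          Σ (Word d₁) λ v → Σ (S₁ v) λ sv → R₁ t v × g t h v sv ≡ u))
  where
    open LogicSystem L₁ renaming (a to a₁; d to d₁; T to T₁; S to S₁; R to R₁)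
    open LogicSystem L₂ renaming (a to a₂; d to d₂; T to T₂; S to S₂; R to R₂)

data Form (V : Set) : Set where
  var       : V → Form V
  ⊤f ⊥f     : Form V
  ¬f_       : Form V → Form V
  _∧f_ _∨f_ _⇒f_ : Form V → Form V → Form V

eval : {V : Set} → (V → Bool) → Form V → Bool
eval ρ (var x)   = ρ x
eval ρ ⊤f        = true
eval ρ ⊥f        = false
eval ρ (¬f φ)    = not (eval ρ φ)
eval ρ (φ ∧f ψ)  = eval ρ φ ∧ eval ρ ψ
eval ρ (φ ∨f ψ)  = eval ρ φ ∨ eval ρ ψ
eval ρ (φ ⇒f ψ)  = not (eval ρ φ) ∨ eval ρ ψ

-- largest index n of a free variable x_n (0 if none); the formula is read
-- as a formula over x₁ … x_n.  ix gives (index of x_i) or 0 for bound vars.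
maxVar : {V : Set} → (V → ℕ) → Form V → ℕ
maxVar ix (var x)  = ix x
maxVar ix ⊤f       = 0
maxVar ix ⊥f       = 0
maxVar ix (¬f φ)   = maxVar ix φ
maxVar ix (φ ∧f ψ) = maxVar ix φ ⊔ maxVar ix ψ
maxVar ix (φ ∨f ψ) = maxVar ix φ ⊔ maxVar ix ψ
maxVar ix (φ ⇒f ψ) = maxVar ix φ ⊔ maxVar ix ψ

data Sym : Set where
  sX sY sI sT sF sN sA sO sM sE : Sym

symCode : Sym → Fin 10
symCode sX = zero
symCode sY = suc (zero)
symCode sI = suc (suc (zero))
symCode sT = suc (suc (suc (zero)))
symCode sF = suc (suc (suc (suc (zero))))
symCode sN = suc (suc (suc (suc (suc (zero)))))
symCode sA = suc (suc (suc (suc (suc (suc (zero))))))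
symCode sO = suc (suc (suc (suc (suc (suc (suc (zero)))))))
symCode sM = suc (suc (suc (suc (suc (suc (suc (suc (zero))))))))
symCode sE = suc (suc (suc (suc (suc (suc (suc (suc (suc (zero)))))))))

encForm : {V : Set} → (V → List Sym) → Form V → List Sym
encForm ev (var x)  = ev x
encForm ev ⊤f       = sT ∷ []
encForm ev ⊥f       = sF ∷ []
encForm ev (¬f φ)   = sN ∷ encForm ev φ
encForm ev (φ ∧f ψ) = sA ∷ encForm ev φ ++ encForm ev ψ
encForm ev (φ ∨f ψ) = sO ∷ encForm ev φ ++ encForm ev ψ
encForm ev (φ ⇒f ψ) = sM ∷ encForm ev φ ++ encForm ev ψ

-- x_i (i ≥ 1) is written  X I…I  (i tallies); var k stands for x_{k+1}
encX : ℕ → List Sym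
encX k = sX ∷ replicate (suc k) sI

-- y_j (j ≥ 1) is written  Y I…I  (j tallies); y : Fin m stands for y_{toℕ y + 1}
encY : ℕ → List Sym
encY k = sY ∷ replicate (suc k) sI

PForm : Set
PForm = Form ℕ

codePF : PForm → Word 10
codePF φ = map symCode (encForm encX φ)

-- ∃PF: Φ = ∃y₁ ⋯ ∃y_m φ with φ over the free x's and the bound y₁ … y_m
record EForm : Set where
  constructor ∃[_]_
  field
    m    : ℕ
    body : Form (ℕ ⊎ Fin m)

codeEPF : EForm → Word 10
codeEPF (∃[ m ] φ) =
  map symCode (concatMap (λ j → sE ∷ encY j) (upTo m)
               ++ encForm [ encX , (λ j → encY (toℕ j)) ] φ)

bit : Word 2 → ℕ → Bool     -- value of x_{k+1}
bit []            _       = false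
bit (zero ∷ _)    zero    = false
bit (suc _ ∷ _)   zero    = true
bit (_ ∷ w)       (suc k) = bit w k

-- set of true atoms of w' is contained in that of w
SubAssign : Word 2 → Word 2 → Set
SubAssign = Pointwise F._≤_

IsModelPF : PForm → Word 2 → Set
IsModelPF φ w = (length w ≡ maxVar suc φ) × (eval (bit w) φ ≡ true)

IsMinModelPF : PForm → Word 2 → Set
IsMinModelPF φ w = IsModelPF φ w ×
  ¬ (Σ (Word 2) λ w′ → IsModelPF φ w′ × SubAssign w′ w × w′ ≢ w)

IsModelEPF : EForm → Word 2 → Set
IsModelEPF (∃[ m ] φ) w =
  (length w ≡ maxVar [ suc , (λ _ → 0) ] φ) ×
  (Σ (Fin m → Bool) λ τ → eval [ bit w , τ ] φ ≡ true)

IsMinModelEPF : EForm → Word 2 → Set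
IsMinModelEPF Φ w = IsModelEPF Φ w ×
  ¬ (Σ (Word 2) λ w′ → IsModelEPF Φ w′ × SubAssign w′ w × w′ ≢ w)

PF : Word 10 → Set
PF t = Σ PForm λ φ → codePF φ ≡ t

EPF : Word 10 → Set
EPF t = Σ EForm λ Φ → codeEPF Φ ≡ t

TA : Word 2 → Set
TA _ = ⊤

MinSat : Word 10 → Word 2 → Set
MinSat t w = Σ PForm λ φ → (codePF φ ≡ t) × IsMinModelPF φ w

FSat : Word 10 → Word 2 → Set
FSat t w = Σ EForm λ Φ → (codeEPF Φ ≡ t) × IsModelEPF Φ w

FMinSat : Word 10 → Word 2 → Set
FMinSat t w = Σ EForm λ Φ → (codeEPF Φ ≡ t) × IsMinModelEPF Φ w

LS-PF-MinSat : LogicSystem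
LS-PF-MinSat = record { a = 10 ; d = 2 ; T = PF ; S = TA ; R = MinSat }

LS-EPF-FSat : LogicSystem
LS-EPF-FSat = record { a = 10 ; d = 2 ; T = EPF ; S = TA ; R = FSat }

LS-EPF-FMinSat : LogicSystem
LS-EPF-FMinSat = record { a = 10 ; d = 2 ; T = EPF ; S = TA ; R = FMinSat }

-- (1) A propositional formula is an existential formula without bound
-- variables; it keeps its code, its models and its minimal models, so the
-- reduction copies both the formula and the assignment.
-- (2) For Φ = ∃ȳ φ(x₁,…,xₙ) take Φ′ = ∃ȳ (φ(x₂,x₄,…,x₂ₙ) ∧ ⋀ᵢ (x₂ᵢ₋₁ ↔ ¬x₂ᵢ)).
-- The models of Φ′ are exactly the interleavings (¬b₁,b₁,…,¬bₙ,bₙ) of the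
-- models b of Φ, and no interleaving lies strictly below another, so every
-- model of Φ′ is minimal and interleaving is the required bijection.
-- All maps are computed by finite-state devices: the assignment maps by
-- one-pass transducers, Φ′ by a transducer that at every input position runs
-- up to four finite-state passes over the remaining suffix.  A single-tape
-- machine simulates such a device in quadratic time by sweeping over the tape.

module Submission where

open import Defs
open import Data.Nat using (ℕ; zero; suc; _+_; _*_; _≤_; _<_; z≤n; s≤s; _⊔_; _≤?_)
open import Data.Nat.Properties
  using (≤-refl; ≤-trans; ≤-reflexive; +-mono-≤; +-monoˡ-≤; *-monoˡ-≤; *-monoʳ-≤; +-assoc; +-comm;
         +-identityʳ; *-zeroʳ; m≤m+n; m≤n+m; n≤1+n; suc-injective; ⊔-lub; ⊔-sel; m≥n⇒m⊔n≡m;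
         m≤n⇒m≤n⊔o; m≤n⇒m≤o⊔n)
open import Data.Nat.Tactic.RingSolver using (solve-∀)
open import Data.Fin as Fin using (Fin; zero; suc; toℕ; _↑ˡ_; _↑ʳ_; splitAt; combine; remQuot)
open import Data.Fin.Properties using (splitAt-↑ˡ; splitAt-↑ʳ; remQuot-combine; toℕ-injective; all?)
open import Data.List
  using (List; []; _∷_; _++_; _ʳ++_; map; length; drop; replicate; concatMap; applyUpTo; upTo; downFrom; foldl)
open import Data.List.Properties
  using (++-assoc; ++-identityʳ; length-++; ++-ʳ++; map-++; map-injective; ++-cancelˡ; ∷-injectiveʳ;
         concatMap-pure; concatMap-++; length-map; length-downFrom)
open import Data.List.Relation.Unary.All as All using (All; []; _∷_)
open import Data.List.Relation.Unary.All.Properties using (++⁺; map⁺; map⁻)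
open import Data.List.Relation.Binary.Pointwise using ([]; _∷_)
open import Data.List.Membership.Propositional using (_∈_)
open import Data.List.Membership.Propositional.Properties using (∈-downFrom⁺; ∈-downFrom⁻; ∈-++⁺ˡ; ∈-++⁺ʳ)
open import Data.Maybe using (Maybe; just; nothing)
import Data.Maybe as Maybe
open import Data.Sum using (_⊎_; inj₁; inj₂; [_,_])
open import Data.Product using (Σ; _×_; _,_; proj₁; proj₂)
open import Data.Unit using (⊤; tt)
open import Data.Empty using (⊥)
open import Data.Bool using (Bool; true; false; not; _∧_; _∨_; if_then_else_)
open import Data.Bool.Properties using (∧-conicalˡ; ∧-conicalʳ; not-involutive)
open import Relation.Binary.PropositionalEquality hiding ([_])
open import Relation.Nullary.Decidable using (toWitness)

record FinCode (A : Set) : Set where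
  field
    size          : ℕ
    encode        : A → Fin size
    decode        : Fin size → A
    decode-encode : ∀ x → decode (encode x) ≡ x

open FinCode

Fin-code : ∀ n → FinCode (Fin n)
Fin-code n = record { size = n ; encode = λ i → i ; decode = λ i → i ; decode-encode = λ _ → refl }

⊤-code : FinCode ⊤
⊤-code = record { size = 1 ; encode = λ _ → zero ; decode = λ _ → tt ; decode-encode = λ _ → refl }

module _ {A B : Set} (cA : FinCode A) (cB : FinCode B) where

  private
    decode-⊎ : Fin (size cA) ⊎ Fin (size cB) → A ⊎ B
    decode-⊎ (inj₁ i) = inj₁ (decode cA i)
    decode-⊎ (inj₂ j) = inj₂ (decode cB j)

    decode-× : Fin (size cA) × Fin (size cB) → A × B
    decode-× (i , j) = decode cA i , decode cB j

  _⊎-code_ : FinCode (A ⊎ B)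
  _⊎-code_ = record
    { size   = size cA + size cB
    ; encode = λ { (inj₁ x) → encode cA x ↑ˡ size cB ; (inj₂ y) → size cA ↑ʳ encode cB y }
    ; decode = λ i → decode-⊎ (splitAt (size cA) i)
    ; decode-encode = λ
        { (inj₁ x) → trans (cong decode-⊎ (splitAt-↑ˡ (size cA) (encode cA x) (size cB)))
                           (cong inj₁ (decode-encode cA x))
        ; (inj₂ y) → trans (cong decode-⊎ (splitAt-↑ʳ (size cA) (size cB) (encode cB y)))
                           (cong inj₂ (decode-encode cB y)) }
    }

  _×-code_ : FinCode (A × B)
  _×-code_ = record
    { size   = size cA * size cB
    ; encode = λ { (x , y) → combine (encode cA x) (encode cB y) }
    ; decode = λ i → decode-× (remQuot (size cB) i)
    ; decode-encode = λ { (x , y) →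
        trans (cong decode-× (remQuot-combine (encode cA x) (encode cB y)))
              (cong₂ _,_ (decode-encode cA x) (decode-encode cB y)) }
    }

retract-code : {A B : Set} (f : A → B) (g : B → A) → (∀ x → g (f x) ≡ x) → FinCode B → FinCode A
retract-code f g gf cB = record
  { size = size cB ; encode = λ x → encode cB (f x) ; decode = λ i → g (decode cB i)
  ; decode-encode = λ x → trans (cong g (decode-encode cB (f x))) (gf x) }

Bool-code : FinCode Bool
Bool-code = retract-code (λ { true → inj₁ tt ; false → inj₂ tt }) (λ { (inj₁ _) → true ; (inj₂ _) → false })
                         (λ { true → refl ; false → refl }) (⊤-code ⊎-code ⊤-code)

Maybe-code : {A : Set} → FinCode A → FinCode (Maybe A)
Maybe-code cA = retract-code (λ { nothing → inj₁ tt ; (just x) → inj₂ x })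
                             (λ { (inj₁ _) → nothing ; (inj₂ x) → just x })
                             (λ { nothing → refl ; (just x) → refl }) (⊤-code ⊎-code cA)

_+ₚ_ : Poly → Poly → Poly
[]       +ₚ q        = q
(c ∷ p)  +ₚ []       = c ∷ p
(c ∷ p)  +ₚ (d ∷ q)  = (c + d) ∷ (p +ₚ q)

evalPoly-+ : ∀ p q x → evalPoly (p +ₚ q) x ≡ evalPoly p x + evalPoly q x
evalPoly-+ []      q       x = refl
evalPoly-+ (c ∷ p) []      x = sym (+-identityʳ _)
evalPoly-+ (c ∷ p) (d ∷ q) x rewrite evalPoly-+ p q x = lemma c d x (evalPoly p x) (evalPoly q x)
  where
    lemma : ∀ c d x P Q → (c + d) + x * (P + Q) ≡ (c + x * P) + (d + x * Q)
    lemma = solve-∀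

_·ₚ_ : ℕ → Poly → Poly
c ·ₚ p = map (c *_) p

evalPoly-· : ∀ c p x → evalPoly (c ·ₚ p) x ≡ c * evalPoly p x
evalPoly-· c []      x = sym (*-zeroʳ c)
evalPoly-· c (d ∷ p) x rewrite evalPoly-· c p x = lemma c d x (evalPoly p x)
  where
    lemma : ∀ c d x P → c * d + x * (c * P) ≡ c * (d + x * P)
    lemma = solve-∀

_*ₚ_ : Poly → Poly → Poly
[]      *ₚ q = []
(c ∷ p) *ₚ q = (c ·ₚ q) +ₚ (0 ∷ (p *ₚ q))

evalPoly-* : ∀ p q x → evalPoly (p *ₚ q) x ≡ evalPoly p x * evalPoly q x
evalPoly-* []      q x = refl
evalPoly-* (c ∷ p) q x
  rewrite evalPoly-+ (c ·ₚ q) (0 ∷ (p *ₚ q)) x | evalPoly-· c q x | evalPoly-* p q x =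
  lemma c x (evalPoly p x) (evalPoly q x)
  where
    lemma : ∀ c x P Q → c * Q + (0 + x * (P * Q)) ≡ (c + x * P) * Q
    lemma = solve-∀

data PolyExpr : Set where
  Var       : PolyExpr
  Const     : ℕ → PolyExpr
  _⊕_ _⊗_   : PolyExpr → PolyExpr → PolyExpr

infixl 6 _⊕_
infixl 7 _⊗_

⟦_⟧ : PolyExpr → ℕ → ℕ
⟦ Var ⟧     x = x
⟦ Const c ⟧   x = c
⟦ e ⊕ f ⟧ x = ⟦ e ⟧ x + ⟦ f ⟧ x
⟦ e ⊗ f ⟧ x = ⟦ e ⟧ x * ⟦ f ⟧ x

toPoly : PolyExpr → Poly
toPoly Var       = 0 ∷ 1 ∷ []
toPoly (Const c)   = c ∷ []
toPoly (e ⊕ f) = toPoly e +ₚ toPoly f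
toPoly (e ⊗ f) = toPoly e *ₚ toPoly f

evalPoly-toPoly : ∀ e x → evalPoly (toPoly e) x ≡ ⟦ e ⟧ x
evalPoly-toPoly Var       x = lemma x
  where
    lemma : ∀ x → 0 + x * (1 + x * 0) ≡ x
    lemma = solve-∀
evalPoly-toPoly (Const c)   x = trans (cong (c +_) (*-zeroʳ x)) (+-identityʳ c)
evalPoly-toPoly (e ⊕ f) x
  rewrite evalPoly-+ (toPoly e) (toPoly f) x | evalPoly-toPoly e x | evalPoly-toPoly f x = refl
evalPoly-toPoly (e ⊗ f) x
  rewrite evalPoly-* (toPoly e) (toPoly f) x | evalPoly-toPoly e x | evalPoly-toPoly f x = refl

-- Multi-pass transducers run in polynomial time

-- Configurations are compared up to trailing blanks, since moving right off the
-- end of the tape creates a blank cell that never has to be written.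
module TapeReasoning {a b : ℕ} (M : TM a b) where
  open TM M
  open Run M public

  Tape : Set
  Tape = List (Cell a b e)

  cellAt : Tape → ℕ → Cell a b e
  cellAt []      _       = nothing
  cellAt (c ∷ l) zero    = c
  cellAt (c ∷ l) (suc i) = cellAt l i

  tail : Tape → Tape
  tail []      = []
  tail (c ∷ l) = l

  record _≈_ (l l′ : Tape) : Set where
    constructor mk≈
    field at : ∀ i → cellAt l i ≡ cellAt l′ i
  open _≈_ public

  ≈-refl : ∀ {l} → l ≈ l
  ≈-refl = mk≈ λ _ → refl

  ≈-reflexive : ∀ {l l′} → l ≡ l′ → l ≈ l′
  ≈-reflexive refl = ≈-refl

  ≈-sym : ∀ {l l′} → l ≈ l′ → l′ ≈ l
  ≈-sym p = mk≈ λ i → sym (at p i)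

  ≈-trans : ∀ {l l′ l″} → l ≈ l′ → l′ ≈ l″ → l ≈ l″
  ≈-trans p q = mk≈ λ i → trans (at p i) (at q i)

  ∷-cong : ∀ c {l l′} → l ≈ l′ → (c ∷ l) ≈ (c ∷ l′)
  ∷-cong c p = mk≈ λ { zero → refl ; (suc i) → at p i }

  tail-cong : ∀ {l l′} → l ≈ l′ → tail l ≈ tail l′
  tail-cong {[]}    {[]}    p = ≈-refl
  tail-cong {[]}    {_ ∷ _} p = mk≈ λ i → at p (suc i)
  tail-cong {_ ∷ _} {[]}    p = mk≈ λ i → at p (suc i)
  tail-cong {_ ∷ _} {_ ∷ _} p = mk≈ λ i → at p (suc i)

  ++⁺ˡ : ∀ (xs : Tape) {l l′} → l ≈ l′ → (xs ++ l) ≈ (xs ++ l′)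
  ++⁺ˡ []       p = p
  ++⁺ˡ (x ∷ xs) p = ∷-cong x (++⁺ˡ xs p)

  ++-blank : ∀ (xs : Tape) → (xs ++ nothing ∷ []) ≈ xs
  ++-blank xs = mk≈ (cellAt-++-blank xs)
    where
      cellAt-++-blank : ∀ (xs : Tape) i → cellAt (xs ++ nothing ∷ []) i ≡ cellAt xs i
      cellAt-++-blank []       zero    = refl
      cellAt-++-blank []       (suc i) = refl
      cellAt-++-blank (x ∷ xs) zero    = refl
      cellAt-++-blank (x ∷ xs) (suc i) = cellAt-++-blank xs i

  _~_ : Config → Config → Set
  ⟨ q , l , h , r ⟩ ~ ⟨ q′ , l′ , h′ , r′ ⟩ = (q ≡ q′) × (l ≈ l′) × (h ≡ h′) × (r ≈ r′)

  ~-refl : ∀ {c} → c ~ c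
  ~-refl {⟨ _ , _ , _ , _ ⟩} = refl , ≈-refl , refl , ≈-refl

  ~-trans : ∀ {c c′ c″} → c ~ c′ → c′ ~ c″ → c ~ c″
  ~-trans {⟨ _ , _ , _ , _ ⟩} {⟨ _ , _ , _ , _ ⟩} {⟨ _ , _ , _ , _ ⟩} (p₁ , p₂ , p₃ , p₄) (q₁ , q₂ , q₃ , q₄) =
    trans p₁ q₁ , ≈-trans p₂ q₂ , trans p₃ q₃ , ≈-trans p₄ q₄

  -- move, reading an exhausted tape half as blank
  moveN : Move → Tape → Cell a b e → Tape → Fin s → Config
  moveN left  l c r q = ⟨ q , tail l , cellAt l 0 , c ∷ r ⟩
  moveN right l c r q = ⟨ q , c ∷ l , cellAt r 0 , tail r ⟩
  moveN stay  l c r q = ⟨ q , l , c , r ⟩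

  move≡moveN : ∀ m l c r q → move m l c r q ≡ moveN m l c r q
  move≡moveN left  []      c r       q = refl
  move≡moveN left  (_ ∷ _) c r       q = refl
  move≡moveN right l       c []      q = refl
  move≡moveN right l       c (_ ∷ _) q = refl
  move≡moveN stay  l       c r       q = refl

  moveN-cong : ∀ m {l l′ r r′} c q → l ≈ l′ → r ≈ r′ → moveN m l c r q ~ moveN m l′ c r′ q
  moveN-cong left  c q pl pr = refl , tail-cong pl , at pl 0 , ∷-cong c pr
  moveN-cong right c q pl pr = refl , ∷-cong c pl , at pr 0 , tail-cong pr
  moveN-cong stay  c q pl pr = refl , pl , refl , pr

  step-cong : ∀ {c c′} → c ~ c′ → step c ~ step c′
  step-cong {⟨ q , l , h , r ⟩} {⟨ .q , l′ , .h , r′ ⟩} (refl , pl , refl , pr) with halt q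
  ... | true  = refl , pl , refl , pr
  ... | false with δ q h
  ... | q′ , c′ , m rewrite move≡moveN m l c′ r q′ | move≡moveN m l′ c′ r′ q′ = moveN-cong m c′ q′ pl pr

  run-cong : ∀ n {c c′} → c ~ c′ → run n c ~ run n c′
  run-cong zero    p = p
  run-cong (suc n) p = run-cong n (step-cong p)

  run-+ : ∀ m n c → run (m + n) c ≡ run n (run m c)
  run-+ zero    n c = refl
  run-+ (suc m) n c = run-+ m n (step c)

  run-1 : ∀ q l h r {q′ c′ m} → halt q ≡ false → δ q h ≡ (q′ , c′ , m) →
          run 1 ⟨ q , l , h , r ⟩ ≡ moveN m l c′ r q′
  run-1 q l h r {q′} {c′} {m} hq dq rewrite hq | dq = move≡moveN m l c′ r q′

  Reach : Config → Config → ℕ → Set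
  Reach c c′ B = Σ ℕ λ k → k ≤ B × (run k c ~ c′)

  reach-~ : ∀ {c c′ B} → c ~ c′ → Reach c c′ B
  reach-~ p = 0 , z≤n , p

  infixr 4 _⟫_

  _⟫_ : ∀ {c₁ c₂ c₃ B₁ B₂} → Reach c₁ c₂ B₁ → Reach c₂ c₃ B₂ → Reach c₁ c₃ (B₁ + B₂)
  _⟫_ {c₁} (k₁ , b₁ , p₁) (k₂ , b₂ , p₂) =
    k₁ + k₂ , +-mono-≤ b₁ b₂ , subst (_~ _) (sym (run-+ k₁ k₂ c₁)) (~-trans (run-cong k₂ p₁) p₂)

  ~-reach : ∀ {c₀ c₁ c₂ B} → c₀ ~ c₁ → Reach c₁ c₂ B → Reach c₀ c₂ B
  ~-reach p (k , b , q) = k , b , ~-trans (run-cong k p) q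

  reach-~′ : ∀ {c₁ c₂ c₃ B} → Reach c₁ c₂ B → c₂ ~ c₃ → Reach c₁ c₃ B
  reach-~′ (k , b , q) p = k , b , ~-trans q p

  reach-mono : ∀ {c₁ c₂ B B′} → B ≤ B′ → Reach c₁ c₂ B → Reach c₁ c₂ B′
  reach-mono le (k , b , q) = k , ≤-trans b le , q

  readOut-cong : ∀ {l l′} → l ≈ l′ → readOut l ≡ readOut l′
  readOut-cong {[]}    {[]}     p = refl
  readOut-cong {[]}    {x ∷ l′} p with at p 0
  ... | refl = refl
  readOut-cong {x ∷ l} {[]}     p with at p 0
  ... | refl = refl
  readOut-cong {x ∷ l} {x′ ∷ l′} p with at p 0
  ... | refl with x
  ... | nothing              = refl
  ... | just (inj₁ _)        = refl
  ... | just (inj₂ (inj₂ _)) = refl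
  ... | just (inj₂ (inj₁ y)) = cong (Maybe.map (y ∷_)) (readOut-cong {l} {l′} (tail-cong p))

  haltsWithin : ∀ {n c w v} → Reach (init w) c n → halt (Config.st c) ≡ true →
                readOut (Config.hd c ∷ Config.rt c) ≡ just v → HaltsWithin n w v
  haltsWithin {c = ⟨ q , l , h , r ⟩} (k , k≤n , (refl , _ , refl , pr)) hl ro =
    k , k≤n , hl , trans (readOut-cong (∷-cong h pr)) ro

PolyTimeComputable : {a b : ℕ} → (List (Fin a) → List (Fin b)) → Set
PolyTimeComputable {a} {b} f =
  Σ Poly λ p → Σ (TM a b) λ M → ∀ w → Run.HaltsWithin M (evalPoly p (length w)) w (f w)

-- An outer automaton reads the input once; at each position, four inner
-- transducers, started in states chosen by the outer state, are run over the
-- remaining suffix and their outputs appended.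
record MultiPass (a b : ℕ) : Set₁ where
  field
    Outer Inner       : Set
    outer-code        : FinCode Outer
    inner-code        : FinCode Inner
    outer₀            : Outer
    outerStep         : Outer → Fin a → Outer
    innerStart        : Outer → Fin 4 → Inner
    innerStep         : Inner → Fin a → Inner × List (Fin b)
    final             : List (Fin b)
    maxOut            : ℕ
    innerStep-bounded : ∀ s x → length (proj₂ (innerStep s x)) ≤ maxOut
    final-bounded     : length final ≤ maxOut

module PassOutput {A B Outer Inner : Set} (outerStep : Outer → A → Outer) (innerStart : Outer → Fin 4 → Inner)
                  (innerStep : Inner → A → Inner × List B) (final : List B) where

  transduce : Inner → List A → List B
  transduce s []       = []
  transduce s (x ∷ xs) = proj₂ (innerStep s x) ++ transduce (proj₁ (innerStep s x)) xs

  passes : Outer → List A → List B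
  passes q v = transduce (innerStart q zero) v ++ (transduce (innerStart q (suc zero)) v ++
               (transduce (innerStart q (suc (suc zero))) v ++ transduce (innerStart q (suc (suc (suc zero)))) v))

  output′ : Outer → List A → List B
  output′ q []       = final
  output′ q (x ∷ xs) = passes q (x ∷ xs) ++ output′ (outerStep q x) xs

relabelStep : {A A′ B B′ S : Set} → (A′ → A) → (B → B′) → (S → A → S × List B) → S → A′ → S × List B′
relabelStep d o step s x = proj₁ (step s (d x)) , map o (proj₂ (step s (d x)))

module _ {A A′ B B′ Outer Inner : Set} (outerStep : Outer → A → Outer) (innerStart : Outer → Fin 4 → Inner)
         (innerStep : Inner → A → Inner × List B) (final : List B)
         (e : A → A′) (d : A′ → A) (d-e : ∀ x → d (e x) ≡ x) (o : B → B′) where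

  private
    module Orig = PassOutput outerStep innerStart innerStep final
    module Rel  = PassOutput (λ q x → outerStep q (d x)) innerStart (relabelStep d o innerStep) (map o final)

  transduce-relabel : ∀ s xs → Rel.transduce s (map e xs) ≡ map o (Orig.transduce s xs)
  transduce-relabel s []       = refl
  transduce-relabel s (x ∷ xs) rewrite d-e x | transduce-relabel (proj₁ (innerStep s x)) xs =
    sym (map-++ o (proj₂ (innerStep s x)) _)

  passes-relabel : ∀ q xs → Rel.passes q (map e xs) ≡ map o (Orig.passes q xs)
  passes-relabel q xs =
    trans (cong₂ _++_ relabel₀ (cong₂ _++_ relabel₁ (cong₂ _++_ relabel₂ relabel₃)))
          (sym (trans (map-++ o r₀ _) (cong (map o r₀ ++_) (trans (map-++ o r₁ _) (cong (map o r₁ ++_) (map-++ o r₂ r₃))))))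
    where
      r₀ = Orig.transduce (innerStart q zero) xs
      r₁ = Orig.transduce (innerStart q (suc zero)) xs
      r₂ = Orig.transduce (innerStart q (suc (suc zero))) xs
      r₃ = Orig.transduce (innerStart q (suc (suc (suc zero)))) xs
      relabel₀ = transduce-relabel (innerStart q zero) xs
      relabel₁ = transduce-relabel (innerStart q (suc zero)) xs
      relabel₂ = transduce-relabel (innerStart q (suc (suc zero))) xs
      relabel₃ = transduce-relabel (innerStart q (suc (suc (suc zero)))) xs

  output′-relabel : ∀ q xs → Rel.output′ q (map e xs) ≡ map o (Orig.output′ q xs)
  output′-relabel q []       = refl
  output′-relabel q (x ∷ xs) =
    trans (cong₂ _++_ (passes-relabel q (x ∷ xs))
                      (trans (cong (λ q′ → Rel.output′ q′ (map e xs)) (cong (outerStep q) (d-e x)))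
                             (output′-relabel (outerStep q x) xs)))
          (sym (map-++ o (Orig.passes q (x ∷ xs)) (Orig.output′ (outerStep q x) xs)))

module MultiPassOutput {a b : ℕ} (S : MultiPass a b) where
  open MultiPass S
  open PassOutput outerStep innerStart innerStep final public

  output : List (Fin a) → List (Fin b)
  output = output′ outer₀

  transduce-length : ∀ s v → length (transduce s v) ≤ length v * maxOut
  transduce-length s []       = z≤n
  transduce-length s (x ∷ xs) =
    ≤-trans (≤-reflexive (length-++ (proj₂ (innerStep s x))))
            (+-mono-≤ (innerStep-bounded s x) (transduce-length _ xs))

  passes-length : ∀ q v → length (passes q v) ≤ 4 * (length v * maxOut)
  passes-length q v =
    ≤-trans (≤-reflexive (length-++ (transduce _ v)))      (+-mono-≤ (transduce-length _ v)
    (≤-trans (≤-reflexive (length-++ (transduce _ v)))     (+-mono-≤ (transduce-length _ v)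
    (≤-trans (≤-reflexive (length-++ (transduce _ v)))     (+-mono-≤ (transduce-length _ v)
    (≤-trans (transduce-length _ v) (≤-reflexive (sym (+-identityʳ _)))))))))

  output′-length : ∀ N q v → length v ≤ N → length (output′ q v) ≤ length v * (4 * (N * maxOut)) + maxOut
  output′-length N q []       _ = final-bounded
  output′-length N q (x ∷ xs) h =
    ≤-trans (≤-reflexive (length-++ (passes q (x ∷ xs))))
    (≤-trans (+-mono-≤ (≤-trans (passes-length q (x ∷ xs)) (*-monoʳ-≤ 4 (*-monoˡ-≤ maxOut h)))
                       (output′-length N (outerStep q x) xs (≤-trans (n≤1+n _) h)))
             (≤-reflexive (sym (+-assoc (4 * (N * maxOut)) (length xs * (4 * (N * maxOut))) maxOut))))

saturatingSuc : ∀ {n} → Fin (suc n) → Fin (suc n)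
saturatingSuc {zero}  zero    = zero
saturatingSuc {suc n} zero    = suc zero
saturatingSuc {suc n} (suc j) = suc (saturatingSuc j)

toℕ-saturatingSuc : ∀ {n} (j : Fin (suc n)) → toℕ j < n → toℕ (saturatingSuc j) ≡ suc (toℕ j)
toℕ-saturatingSuc {suc n} zero    _       = refl
toℕ-saturatingSuc {suc n} (suc j) (s≤s p) = cong suc (toℕ-saturatingSuc j p)

drop-∷ : ∀ {A : Set} (l : List A) k {y ys} → drop k l ≡ y ∷ ys → drop (suc k) l ≡ ys × k < length l
drop-∷ (x ∷ l) zero    refl = refl , s≤s z≤n
drop-∷ (x ∷ l) (suc k) p    = let (d , lt) = drop-∷ l k p in d , s≤s lt

drop-saturatingSuc : ∀ {A : Set} {n} (l : List A) (j : Fin (suc n)) {y ys} → length l ≤ n →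
            drop (toℕ j) l ≡ y ∷ ys → drop (toℕ (saturatingSuc j)) l ≡ ys
drop-saturatingSuc l j l≤n p with drop-∷ l (toℕ j) p
... | d , lt rewrite toℕ-saturatingSuc j (≤-trans lt l≤n) = d

module MultiPassMachine {a b : ℕ} (S : MultiPass a b) where
  open MultiPass S
  open MultiPassOutput S

  Index : Set
  Index = Fin (suc maxOut)

  -- The tape holds the input suffix still to be processed, a blank and the
  -- output written so far.
  -- During pass p, input cells already fed to the inner transducer are marked
  -- (work symbol x instead of input symbol x); the pending inner output is
  -- written at the end of the tape from the given Index on.
  data Mode : Set where
    Start     : Outer → Fin 4 → Mode
    Read      : Outer → Fin 4 → Inner → Mode
    ToGap     : Outer → Fin 4 → Inner → Fin a → Index → Mode
    ToEnd     : Outer → Fin 4 → Inner → Fin a → Index → Mode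
    BackOut   : Outer → Fin 4 → Inner → Mode
    BackIn    : Outer → Fin 4 → Inner → Mode
    Unmark    : Outer → Fin 4 → Mode
    Erase     : Outer → Mode
    WriteLast : Index → Mode
    BackLast  : Mode
    Halt      : Mode

  private
    Args₅ Args₃ Args₂ : Set
    Args₅ = Outer × (Fin 4 × (Inner × (Fin a × Index)))
    Args₃ = Outer × (Fin 4 × Inner)
    Args₂ = Outer × Fin 4

    ModeSum : Set
    ModeSum = Args₂ ⊎ (Args₃ ⊎ (Args₅ ⊎ (Args₅ ⊎ (Args₃ ⊎ (Args₃ ⊎ (Args₂ ⊎ (Outer ⊎ (Index ⊎ (⊤ ⊎ ⊤)))))))))

    toSum : Mode → ModeSum
    toSum (Start q p)         = inj₁ (q , p)
    toSum (Read q p s)        = inj₂ (inj₁ (q , p , s))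
    toSum (ToGap q p s x j)   = inj₂ (inj₂ (inj₁ (q , p , s , x , j)))
    toSum (ToEnd q p s x j)   = inj₂ (inj₂ (inj₂ (inj₁ (q , p , s , x , j))))
    toSum (BackOut q p s)     = inj₂ (inj₂ (inj₂ (inj₂ (inj₁ (q , p , s)))))
    toSum (BackIn q p s)      = inj₂ (inj₂ (inj₂ (inj₂ (inj₂ (inj₁ (q , p , s))))))
    toSum (Unmark q p)        = inj₂ (inj₂ (inj₂ (inj₂ (inj₂ (inj₂ (inj₁ (q , p)))))))
    toSum (Erase q)           = inj₂ (inj₂ (inj₂ (inj₂ (inj₂ (inj₂ (inj₂ (inj₁ q)))))))
    toSum (WriteLast j)       = inj₂ (inj₂ (inj₂ (inj₂ (inj₂ (inj₂ (inj₂ (inj₂ (inj₁ j))))))))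
    toSum BackLast            = inj₂ (inj₂ (inj₂ (inj₂ (inj₂ (inj₂ (inj₂ (inj₂ (inj₂ (inj₁ tt)))))))))
    toSum Halt                = inj₂ (inj₂ (inj₂ (inj₂ (inj₂ (inj₂ (inj₂ (inj₂ (inj₂ (inj₂ tt)))))))))

    fromSum : ModeSum → Mode
    fromSum (inj₁ (q , p))                                                         = Start q p
    fromSum (inj₂ (inj₁ (q , p , s)))                                              = Read q p s
    fromSum (inj₂ (inj₂ (inj₁ (q , p , s , x , j))))                               = ToGap q p s x j
    fromSum (inj₂ (inj₂ (inj₂ (inj₁ (q , p , s , x , j)))))                        = ToEnd q p s x j
    fromSum (inj₂ (inj₂ (inj₂ (inj₂ (inj₁ (q , p , s))))))                         = BackOut q p s
    fromSum (inj₂ (inj₂ (inj₂ (inj₂ (inj₂ (inj₁ (q , p , s)))))))                  = BackIn q p s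
    fromSum (inj₂ (inj₂ (inj₂ (inj₂ (inj₂ (inj₂ (inj₁ (q , p))))))))               = Unmark q p
    fromSum (inj₂ (inj₂ (inj₂ (inj₂ (inj₂ (inj₂ (inj₂ (inj₁ q))))))))              = Erase q
    fromSum (inj₂ (inj₂ (inj₂ (inj₂ (inj₂ (inj₂ (inj₂ (inj₂ (inj₁ j)))))))))       = WriteLast j
    fromSum (inj₂ (inj₂ (inj₂ (inj₂ (inj₂ (inj₂ (inj₂ (inj₂ (inj₂ (inj₁ _)))))))))) = BackLast
    fromSum (inj₂ (inj₂ (inj₂ (inj₂ (inj₂ (inj₂ (inj₂ (inj₂ (inj₂ (inj₂ _)))))))))) = Halt

    fromSum-toSum : ∀ m → fromSum (toSum m) ≡ m
    fromSum-toSum (Start _ _)       = refl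
    fromSum-toSum (Read _ _ _)      = refl
    fromSum-toSum (ToGap _ _ _ _ _) = refl
    fromSum-toSum (ToEnd _ _ _ _ _) = refl
    fromSum-toSum (BackOut _ _ _)   = refl
    fromSum-toSum (BackIn _ _ _)    = refl
    fromSum-toSum (Unmark _ _)      = refl
    fromSum-toSum (Erase _)         = refl
    fromSum-toSum (WriteLast _)     = refl
    fromSum-toSum BackLast          = refl
    fromSum-toSum Halt              = refl

    c₅ : FinCode Args₅
    c₅ = outer-code ×-code (Fin-code 4 ×-code (inner-code ×-code (Fin-code a ×-code Fin-code (suc maxOut))))

    c₃ : FinCode Args₃
    c₃ = outer-code ×-code (Fin-code 4 ×-code inner-code)

    c₂ : FinCode Args₂
    c₂ = outer-code ×-code Fin-code 4

  Mode-code : FinCode Mode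
  Mode-code = retract-code toSum fromSum fromSum-toSum
    (c₂ ⊎-code (c₃ ⊎-code (c₅ ⊎-code (c₅ ⊎-code (c₃ ⊎-code (c₃ ⊎-code (c₂ ⊎-code
      (outer-code ⊎-code (Fin-code (suc maxOut) ⊎-code (⊤-code ⊎-code ⊤-code))))))))))

  C : Set
  C = Cell a b a

  inC : Fin a → C
  inC x = just (inj₁ x)

  outC : Fin b → C
  outC y = just (inj₂ (inj₁ y))

  markC : Fin a → C
  markC x = just (inj₂ (inj₂ x))

  nextPass : Outer → Fin 4 → Mode
  nextPass q zero                   = Start q (suc zero)
  nextPass q (suc zero)             = Start q (suc (suc zero))
  nextPass q (suc (suc zero))       = Start q (suc (suc (suc zero)))
  nextPass q (suc (suc (suc zero))) = Erase q

  Action : Set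
  Action = Mode × C × Move

  writeInner : Outer → Fin 4 → Inner → Fin a → Index → List (Fin b) → Action
  writeInner q p s x j (y ∷ _) = ToEnd q p s x (saturatingSuc j) , outC y , right
  writeInner q p s x j []      = BackOut q p (proj₁ (innerStep s x)) , nothing , left

  writeFinal : Index → List (Fin b) → Action
  writeFinal j (y ∷ _) = WriteLast (saturatingSuc j) , outC y , right
  writeFinal j []      = BackLast , nothing , left

  Δ : Mode → C → Action
  Δ (Start q p)       (just (inj₁ x))        = Read q p (innerStart q p) , inC x , stay
  Δ (Start q p)       nothing                = WriteLast zero , nothing , right
  Δ (Read q p s)      (just (inj₁ x))        = ToGap q p s x zero , markC x , right
  Δ (Read q p s)      nothing                = Unmark q p , nothing , left
  Δ (ToGap q p s x j) (just (inj₁ y))        = ToGap q p s x j , inC y , right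
  Δ (ToGap q p s x j) nothing                = ToEnd q p s x j , nothing , right
  Δ (ToEnd q p s x j) (just (inj₂ (inj₁ y))) = ToEnd q p s x j , outC y , right
  Δ (ToEnd q p s x j) nothing                = writeInner q p s x j (drop (toℕ j) (proj₂ (innerStep s x)))
  Δ (BackOut q p s)   (just (inj₂ (inj₁ y))) = BackOut q p s , outC y , left
  Δ (BackOut q p s)   nothing                = BackIn q p s , nothing , left
  Δ (BackIn q p s)    (just (inj₁ y))        = BackIn q p s , inC y , left
  Δ (BackIn q p s)    (just (inj₂ (inj₂ y))) = Read q p s , markC y , right
  Δ (Unmark q p)      (just (inj₂ (inj₂ y))) = Unmark q p , inC y , left
  Δ (Unmark q p)      nothing                = nextPass q p , nothing , right
  Δ (Erase q)         (just (inj₁ x))        = Start (outerStep q x) zero , nothing , right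
  Δ (WriteLast j)     (just (inj₂ (inj₁ y))) = WriteLast j , outC y , right
  Δ (WriteLast j)     nothing                = writeFinal j (drop (toℕ j) final)
  Δ BackLast          (just (inj₂ (inj₁ y))) = BackLast , outC y , left
  Δ BackLast          nothing                = Halt , nothing , right
  Δ _                 c                      = Halt , c , stay

  isHalt : Mode → Bool
  isHalt Halt = true
  isHalt _    = false

  machine : TM a b
  machine = record
    { e     = a
    ; s     = size Mode-code
    ; start = encode Mode-code (Start outer₀ zero)
    ; halt  = λ i → isHalt (decode Mode-code i)
    ; δ     = λ i c → let (m , c′ , d) = Δ (decode Mode-code i) c in encode Mode-code m , c′ , d
    }

  open TapeReasoning machine

  at▸ : Mode → Tape → Tape → Config
  at▸ m L R = ⟨ encode Mode-code m , L , cellAt R 0 , tail R ⟩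

  at◂ : Mode → Tape → Tape → Config
  at◂ m L R = ⟨ encode Mode-code m , tail L , cellAt L 0 , R ⟩

  at▸-cong : ∀ m {L L′ R R′} → L ≈ L′ → R ≈ R′ → at▸ m L R ~ at▸ m L′ R′
  at▸-cong m pL pR = refl , pL , at pR 0 , tail-cong pR

  run-1-Δ : ∀ m L R {m′ c′ d} → isHalt m ≡ false → Δ m (cellAt R 0) ≡ (m′ , c′ , d) →
            run 1 (at▸ m L R) ≡ moveN d L c′ (tail R) (encode Mode-code m′)
  run-1-Δ m L R {m′} {c′} {d} hm Δm =
    run-1 (encode Mode-code m) L (cellAt R 0) (tail R)
      (trans (cong isHalt (decode-encode Mode-code m)) hm)
      (trans (cong (λ m″ → let (m‴ , c″ , d′) = Δ m″ (cellAt R 0) in encode Mode-code m‴ , c″ , d′)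
                   (decode-encode Mode-code m))
             (cong (λ t → encode Mode-code (proj₁ t) , proj₂ t) Δm))

  step▸ : ∀ m L R {m′ c′ d} → isHalt m ≡ false → Δ m (cellAt R 0) ≡ (m′ , c′ , d) →
          Reach (at▸ m L R) (moveN d L c′ (tail R) (encode Mode-code m′)) 1
  step▸ m L R hm Δm = 1 , ≤-refl , subst (_~ _) (sym (run-1-Δ m L R hm Δm)) ~-refl

  stepRight : ∀ m L R {m′ c′} → isHalt m ≡ false → Δ m (cellAt R 0) ≡ (m′ , c′ , right) →
              Reach (at▸ m L R) (at▸ m′ (c′ ∷ L) (tail R)) 1
  stepRight m L R = step▸ m L R

  stepLeft : ∀ m L R {m′ c′} → isHalt m ≡ false → Δ m (cellAt R 0) ≡ (m′ , c′ , left) →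
             Reach (at▸ m L R) (at◂ m′ L (c′ ∷ tail R)) 1
  stepLeft m L R = step▸ m L R

  stepStay : ∀ m L R {m′ c′} → isHalt m ≡ false → Δ m (cellAt R 0) ≡ (m′ , c′ , stay) →
             Reach (at▸ m L R) (at▸ m′ L (c′ ∷ tail R)) 1
  stepStay m L R = step▸ m L R

  scanRight : ∀ {X : Set} m (g : X → C) → isHalt m ≡ false → (∀ x → Δ m (g x) ≡ (m , g x , right)) →
              ∀ xs L R → Reach (at▸ m L (map g xs ++ R)) (at▸ m (map g xs ʳ++ L) R) (length xs)
  scanRight m g hm Δm []       L R = reach-~ ~-refl
  scanRight m g hm Δm (x ∷ xs) L R =
    stepRight m L (g x ∷ map g xs ++ R) hm (Δm x) ⟫ scanRight m g hm Δm xs (g x ∷ L) R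

  scanLeft : ∀ {X : Set} m (g g′ : X → C) → isHalt m ≡ false → (∀ x → Δ m (g x) ≡ (m , g′ x , left)) →
             ∀ xs L R → Reach (at◂ m (map g xs ʳ++ L) R) (at◂ m L (map g′ xs ++ R)) (length xs)
  scanLeft m g g′ hm Δm []       L R = reach-~ ~-refl
  scanLeft m g g′ hm Δm (x ∷ xs) L R =
    reach-mono (≤-reflexive (+-comm (length xs) 1))
      (scanLeft m g g′ hm Δm xs (g x ∷ L) R ⟫ stepLeft m L (g x ∷ map g′ xs ++ R) hm (Δm x))

  writeInnerOutput : ∀ q p s x (P : List (Fin b)) (j : Index) L → drop (toℕ j) (proj₂ (innerStep s x)) ≡ P →
    Reach (at▸ (ToEnd q p s x j) L [])
          (at◂ (BackOut q p (proj₁ (innerStep s x))) (map outC P ʳ++ L) (nothing ∷ [])) (suc (length P))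
  writeInnerOutput q p s x []      j L eq = stepLeft (ToEnd q p s x j) L [] refl (cong (writeInner q p s x j) eq)
  writeInnerOutput q p s x (y ∷ P) j L eq =
    stepRight (ToEnd q p s x j) L [] refl (cong (writeInner q p s x j) eq) ⟫
    writeInnerOutput q p s x P (saturatingSuc j) (outC y ∷ L)
      (drop-saturatingSuc (proj₂ (innerStep s x)) j (innerStep-bounded s x) eq)

  writeFinalOutput : ∀ (P : List (Fin b)) (j : Index) L → drop (toℕ j) final ≡ P →
    Reach (at▸ (WriteLast j) L []) (at◂ BackLast (map outC P ʳ++ L) (nothing ∷ [])) (suc (length P))
  writeFinalOutput []      j L eq = stepLeft (WriteLast j) L [] refl (cong (writeFinal j) eq)
  writeFinalOutput (y ∷ P) j L eq =
    stepRight (WriteLast j) L [] refl (cong (writeFinal j) eq) ⟫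
    writeFinalOutput P (saturatingSuc j) (outC y ∷ L) (drop-saturatingSuc final j final-bounded eq)

  gap : List (Fin b) → Tape
  gap O = nothing ∷ map outC O

  pass-step : ∀ q p s z zs O Lm →
    Reach (at▸ (Read q p s) Lm (inC z ∷ map inC zs ++ gap O))
          (at▸ (Read q p (proj₁ (innerStep s z))) (markC z ∷ Lm) (map inC zs ++ gap (O ++ proj₂ (innerStep s z))))
          (1 + (length zs + (1 + (length O + (suc (length (proj₂ (innerStep s z))) +
            (length (O ++ proj₂ (innerStep s z)) + (1 + (length zs + 1))))))))
  pass-step q p s z zs O Lm =
    stepRight (Read q p s) Lm (inC z ∷ map inC zs ++ gap O) refl refl ⟫
    scanRight (ToGap q p s z zero) inC refl (λ _ → refl) zs (markC z ∷ Lm) (gap O) ⟫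
    stepRight (ToGap q p s z zero) (map inC zs ʳ++ markC z ∷ Lm) (gap O) refl refl ⟫
    ~-reach (at▸-cong (ToEnd q p s z zero) ≈-refl (≈-reflexive (sym (++-identityʳ (map outC O)))))
            (scanRight (ToEnd q p s z zero) outC refl (λ _ → refl) O Back []) ⟫
    writeInnerOutput q p s z P zero (map outC O ʳ++ Back) refl ⟫
    subst (λ Y → Reach (at◂ (BackOut q p s′) Y (nothing ∷ [])) _ _) (sym reversed-output)
      (scanLeft (BackOut q p s′) outC outC refl (λ _ → refl) (O ++ P) Back (nothing ∷ []) ⟫
       stepLeft (BackOut q p s′) (tail Back) (nothing ∷ map outC (O ++ P) ++ nothing ∷ []) refl refl ⟫
       scanLeft (BackIn q p s′) inC inC refl (λ _ → refl) zs (markC z ∷ Lm) (gap (O ++ P) ++ nothing ∷ []) ⟫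
       reach-~′ (stepRight (BackIn q p s′) Lm (markC z ∷ map inC zs ++ gap (O ++ P) ++ nothing ∷ []) refl refl)
                (at▸-cong (Read q p s′) ≈-refl (++⁺ˡ (map inC zs) (∷-cong nothing (++-blank (map outC (O ++ P)))))))
    where
      P    = proj₂ (innerStep s z)
      s′   = proj₁ (innerStep s z)
      Back = nothing ∷ (map inC zs ʳ++ (markC z ∷ Lm))
      reversed-output : map outC P ʳ++ map outC O ʳ++ Back ≡ map outC (O ++ P) ʳ++ Back
      reversed-output = trans (sym (++-ʳ++ (map outC O))) (cong (_ʳ++ Back) (sym (map-++ outC O P)))

  pass-step-bound : ∀ N W (zs : List (Fin a)) (O P : List (Fin b)) → length zs ≤ N → length (O ++ P) ≤ W →
    1 + (length zs + (1 + (length O + (suc (length P) + (length (O ++ P) + (1 + (length zs + 1))))))) ≤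
    2 * N + 2 * W + 5
  pass-step-bound N W zs O P zs≤N OP≤W =
    ≤-trans (≤-reflexive (lemma (length zs) (length O) (length P) (length (O ++ P))))
      (+-monoˡ-≤ 5 (+-mono-≤ (*-monoʳ-≤ 2 zs≤N)
        (+-mono-≤ (≤-trans (≤-reflexive (sym (length-++ O))) OP≤W) (+-mono-≤ OP≤W ≤-refl))))
    where
      lemma : ∀ z o p op → 1 + (z + (1 + (o + (suc p + (op + (1 + (z + 1))))))) ≡ 2 * z + (o + p + (op + 0)) + 5
      lemma = solve-∀

  -- one full pass: the marked prefix ms has been read, zs is still to be read
  pass : ∀ N W q p s ms zs O → length (ms ++ zs) ≤ N → length (O ++ transduce s zs) ≤ W →
    Reach (at▸ (Read q p s) (map markC ms ʳ++ []) (map inC zs ++ gap O))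
          (at▸ (nextPass q p) [] (map inC (ms ++ zs) ++ gap (O ++ transduce s zs)))
          (length zs * (2 * N + 2 * W + 5) + (N + 2))
  pass N W q p s ms [] O ms≤N _ =
    subst (λ c → Reach (at▸ (Read q p s) (map markC ms ʳ++ []) (gap O)) c (N + 2))
          (cong₂ (λ u v → at▸ (nextPass q p) [] (map inC u ++ gap v)) (sym (++-identityʳ ms)) (sym (++-identityʳ O)))
      (reach-mono (≤-trans (≤-reflexive (lemma (length ms)))
                           (+-monoˡ-≤ 2 (≤-trans (≤-reflexive (cong length (sym (++-identityʳ ms)))) ms≤N)))
        (stepLeft (Read q p s) (map markC ms ʳ++ []) (gap O) refl refl ⟫
         scanLeft (Unmark q p) markC inC refl (λ _ → refl) ms [] (gap O) ⟫
         reach-~′ (stepRight (Unmark q p) [] (nothing ∷ map inC ms ++ gap O) refl refl)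
                  (at▸-cong (nextPass q p) {R = map inC ms ++ gap O} (++-blank []) ≈-refl)))
    where
      lemma : ∀ m → 1 + (m + 1) ≡ m + 2
      lemma = solve-∀
  pass N W q p s ms (z ∷ zs) O ms≤N out≤W =
    subst (λ c → Reach (at▸ (Read q p s) (map markC ms ʳ++ []) (map inC (z ∷ zs) ++ gap O)) c
                       (length (z ∷ zs) * K + (N + 2)))
          (cong₂ (λ u v → at▸ (nextPass q p) [] (map inC u ++ gap v)) ms-z-zs O-P-rest)
      (reach-mono (≤-trans (+-monoˡ-≤ (length zs * K + (N + 2)) (pass-step-bound N W zs O P zs≤N OP≤W))
                           (≤-reflexive (sym (+-assoc K (length zs * K) (N + 2)))))
        (pass-step q p s z zs O (map markC ms ʳ++ []) ⟫
         subst (λ Lm → Reach (at▸ (Read q p s′) Lm (map inC zs ++ gap (O ++ P)))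
                             (at▸ (nextPass q p) [] (map inC ((ms ++ z ∷ []) ++ zs) ++ gap ((O ++ P) ++ transduce s′ zs)))
                             (length zs * K + (N + 2)))
               marked-snoc
           (pass N W q p s′ (ms ++ z ∷ []) zs (O ++ P)
                 (subst (λ u → length u ≤ N) (sym ms-z-zs) ms≤N) (subst (λ u → length u ≤ W) (sym O-P-rest) out≤W))))
    where
      K  = 2 * N + 2 * W + 5
      P    = proj₂ (innerStep s z)
      s′   = proj₁ (innerStep s z)
      marked-snoc : map markC (ms ++ z ∷ []) ʳ++ [] ≡ markC z ∷ (map markC ms ʳ++ [])
      marked-snoc = trans (cong (_ʳ++ []) (map-++ markC ms (z ∷ []))) (++-ʳ++ (map markC ms))
      ms-z-zs : (ms ++ z ∷ []) ++ zs ≡ ms ++ z ∷ zs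
      ms-z-zs = ++-assoc ms (z ∷ []) zs
      O-P-rest : (O ++ P) ++ transduce s′ zs ≡ O ++ transduce s (z ∷ zs)
      O-P-rest = ++-assoc O P (transduce s′ zs)
      zs≤N : length zs ≤ N
      zs≤N = ≤-trans (m≤n+m (length zs) (length (ms ++ z ∷ [])))
               (≤-trans (≤-reflexive (sym (length-++ (ms ++ z ∷ []))))
                        (subst (λ u → length u ≤ N) (sym ms-z-zs) ms≤N))
      OP≤W : length (O ++ P) ≤ W
      OP≤W = ≤-trans (≤-trans (m≤m+n _ _) (≤-reflexive (sym (length-++ (O ++ P)))))
                     (subst (λ u → length u ≤ W) (sym O-P-rest) out≤W)

  starting : Outer → Fin 4 → List (Fin a) → List (Fin b) → Config
  starting q p v O = at▸ (Start q p) [] (map inC v ++ gap O)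

  halted : List (Fin b) → Config
  halted O = at▸ Halt [] (map outC O)

  prefix-≤ : ∀ {W} (A B : List (Fin b)) → length (A ++ B) ≤ W → length A ≤ W
  prefix-≤ A B h = ≤-trans (≤-trans (m≤m+n _ _) (≤-reflexive (sym (length-++ A)))) h

  module Bounds (N W : ℕ) where

    passB positionB finalB : ℕ
    passB     = N * (2 * N + 2 * W + 5) + (N + 2)
    positionB = 4 * (1 + passB) + 1
    finalB    = 2 * W + 3

    start-pass : ∀ q p x xs O → length (x ∷ xs) ≤ N → length (O ++ transduce (innerStart q p) (x ∷ xs)) ≤ W →
      Reach (starting q p (x ∷ xs) O)
            (at▸ (nextPass q p) [] (map inC (x ∷ xs) ++ gap (O ++ transduce (innerStart q p) (x ∷ xs)))) (1 + passB)
    start-pass q p x xs O v≤N out≤W =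
      stepStay (Start q p) [] (map inC (x ∷ xs) ++ gap O) refl refl ⟫
      reach-mono (+-monoˡ-≤ (N + 2) (*-monoˡ-≤ (2 * N + 2 * W + 5) v≤N))
                 (pass N W q p (innerStart q p) [] (x ∷ xs) O v≤N out≤W)

    position : ∀ q x xs O → length (x ∷ xs) ≤ N → length (O ++ passes q (x ∷ xs)) ≤ W →
      Reach (starting q zero (x ∷ xs) O) (starting (outerStep q x) zero xs (O ++ passes q (x ∷ xs))) positionB
    position q x xs O v≤N out≤W =
      subst (λ c → Reach (starting q zero v O) c positionB) (cong (starting (outerStep q x) zero xs) O₃≡)
        (reach-mono (≤-reflexive (lemma passB))
          (start-pass q p₀ x xs O  v≤N O₀≤W ⟫
           start-pass q p₁ x xs O₀ v≤N O₁≤W ⟫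
           start-pass q p₂ x xs O₁ v≤N O₂≤W ⟫
           start-pass q p₃ x xs O₂ v≤N O₃≤W ⟫
           reach-~′ (stepRight (Erase q) [] (map inC v ++ gap O₃) refl refl)
                    (at▸-cong (Start (outerStep q x) zero) {R = map inC xs ++ gap O₃} (++-blank []) ≈-refl)))
      where
        v = x ∷ xs
        p₀ p₁ p₂ p₃ : Fin 4
        p₀ = zero
        p₁ = suc zero
        p₂ = suc (suc zero)
        p₃ = suc (suc (suc zero))
        r₀ = transduce (innerStart q p₀) v
        r₁ = transduce (innerStart q p₁) v
        r₂ = transduce (innerStart q p₂) v
        r₃ = transduce (innerStart q p₃) v
        O₀ = O ++ r₀
        O₁ = O₀ ++ r₁
        O₂ = O₁ ++ r₂
        O₃ = O₂ ++ r₃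
        O₃≡ : O₃ ≡ O ++ passes q v
        O₃≡ = trans (++-assoc O₁ r₂ r₃) (trans (++-assoc O₀ r₁ (r₂ ++ r₃)) (++-assoc O r₀ (r₁ ++ (r₂ ++ r₃))))
        O₃≤W : length O₃ ≤ W
        O₃≤W = subst (λ u → length u ≤ W) (sym O₃≡) out≤W
        O₂≤W = prefix-≤ O₂ r₃ O₃≤W
        O₁≤W = prefix-≤ O₁ r₂ O₂≤W
        O₀≤W = prefix-≤ O₀ r₁ O₁≤W
        lemma : ∀ t → (1 + t) + ((1 + t) + ((1 + t) + ((1 + t) + 1))) ≡ 4 * (1 + t) + 1
        lemma = solve-∀

    finish : ∀ q p O → length (O ++ final) ≤ W → Reach (starting q p [] O) (halted (O ++ final)) finalB
    finish q p O out≤W =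
      reach-mono (≤-trans (≤-reflexive (lemma (length O) (length final) (length (O ++ final))))
                          (+-monoˡ-≤ 3 (+-mono-≤ (≤-trans (≤-reflexive (sym (length-++ O))) out≤W)
                                                 (+-mono-≤ out≤W ≤-refl))))
        (stepRight (Start q p) [] (gap O) refl refl ⟫
         ~-reach (at▸-cong (WriteLast zero) ≈-refl (≈-reflexive (sym (++-identityʳ (map outC O)))))
                 (scanRight (WriteLast zero) outC refl (λ _ → refl) O (nothing ∷ []) []) ⟫
         writeFinalOutput final zero (map outC O ʳ++ nothing ∷ []) refl ⟫
         subst (λ Y → Reach (at◂ BackLast Y (nothing ∷ [])) (halted (O ++ final)) (length (O ++ final) + 1))
               (sym reversed-output)
           (scanLeft BackLast outC outC refl (λ _ → refl) (O ++ final) (nothing ∷ []) (nothing ∷ []) ⟫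
            reach-~′ (stepRight BackLast [] (nothing ∷ map outC (O ++ final) ++ nothing ∷ []) refl refl)
                     (at▸-cong Halt (++-blank []) (++-blank (map outC (O ++ final))))))
      where
        lemma : ∀ o f of → 1 + (o + (suc f + (of + 1))) ≡ (o + f) + (of + 0) + 3
        lemma = solve-∀
        reversed-output : map outC final ʳ++ map outC O ʳ++ nothing ∷ [] ≡ map outC (O ++ final) ʳ++ nothing ∷ []
        reversed-output = trans (sym (++-ʳ++ (map outC O))) (cong (_ʳ++ (nothing ∷ [])) (sym (map-++ outC O final)))

    all-positions : ∀ q v O → length v ≤ N → length (O ++ output′ q v) ≤ W →
      Reach (starting q zero v O) (halted (O ++ output′ q v)) (length v * positionB + finalB)
    all-positions q []       O _   out≤W = finish q zero O out≤W
    all-positions q (x ∷ xs) O v≤N out≤W =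
      subst (λ c → Reach (starting q zero (x ∷ xs) O) c (length (x ∷ xs) * positionB + finalB)) (cong halted O-rest)
        (reach-mono (≤-reflexive (sym (+-assoc positionB (length xs * positionB) finalB)))
          (position q x xs O v≤N (prefix-≤ (O ++ passes q (x ∷ xs)) _ out≤W′) ⟫
           all-positions (outerStep q x) xs (O ++ passes q (x ∷ xs)) (≤-trans (n≤1+n _) v≤N) out≤W′))
      where
        O-rest : (O ++ passes q (x ∷ xs)) ++ output′ (outerStep q x) xs ≡ O ++ output′ q (x ∷ xs)
        O-rest = ++-assoc O (passes q (x ∷ xs)) (output′ (outerStep q x) xs)
        out≤W′ : length ((O ++ passes q (x ∷ xs)) ++ output′ (outerStep q x) xs) ≤ W
        out≤W′ = subst (λ u → length u ≤ W) (sym O-rest) out≤W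

  readOut-halted : ∀ O → readOut (Config.hd (halted O) ∷ Config.rt (halted O)) ≡ just O
  readOut-halted []      = refl
  readOut-halted (y ∷ O) = cong (Maybe.map (y ∷_)) (readOut-outC O)
    where
      readOut-outC : ∀ O → readOut (map outC O) ≡ just O
      readOut-outC []      = refl
      readOut-outC (y ∷ O) = cong (Maybe.map (y ∷_)) (readOut-outC O)

  init~starting : ∀ w → init w ~ starting outer₀ zero w []
  init~starting []      = ~-refl
  init~starting (x ∷ w) = refl , ≈-refl , refl , ≈-sym (++-blank (map inC w))

  machine-halts : ∀ w N W → length w ≤ N → length (output w) ≤ W →
    HaltsWithin (length w * Bounds.positionB N W + Bounds.finalB N W) w (output w)
  machine-halts w N W w≤N out≤W =
    haltsWithin (~-reach (init~starting w) (Bounds.all-positions N W outer₀ w [] w≤N out≤W))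
                (cong isHalt (decode-encode Mode-code Halt)) (readOut-halted (output w))

multiPass-computable : ∀ {a b} (S : MultiPass a b) → PolyTimeComputable (MultiPassOutput.output S)
multiPass-computable S =
  toPoly timeE , machine , λ w →
    subst (λ n → Run.HaltsWithin machine n w (output w)) (sym (evalPoly-toPoly timeE (length w)))
      (machine-halts w (length w) (outputB (length w)) ≤-refl (output′-length (length w) outer₀ w ≤-refl))
  where
    open MultiPass S
    open MultiPassOutput S
    open MultiPassMachine S
    outputB : ℕ → ℕ
    outputB n = n * (4 * (n * maxOut)) + maxOut
    outputE = Var ⊗ (Const 4 ⊗ (Var ⊗ Const maxOut)) ⊕ Const maxOut
    passE   = Var ⊗ (Const 2 ⊗ Var ⊕ Const 2 ⊗ outputE ⊕ Const 5) ⊕ (Var ⊕ Const 2)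
    timeE   = Var ⊗ (Const 4 ⊗ (Const 1 ⊕ passE) ⊕ Const 1) ⊕ (Const 2 ⊗ outputE ⊕ Const 3)

record Transducer (a b : ℕ) : Set₁ where
  field
    State        : Set
    state-code   : FinCode State
    state₀       : State
    step         : State → Fin a → State × List (Fin b)
    maxOut       : ℕ
    step-bounded : ∀ s x → length (proj₂ (step s x)) ≤ maxOut

  translate : State → List (Fin a) → List (Fin b)
  translate s []       = []
  translate s (x ∷ xs) = proj₂ (step s x) ++ translate (proj₁ (step s x)) xs

module SinglePass {a b : ℕ} (T : Transducer a b) where
  open Transducer T

  -- the transducer runs only in pass 0 of the first input position
  start : Bool → Fin 4 → Maybe State
  start true zero = just state₀
  start _    _    = nothing

  step′ : Maybe State → Fin a → Maybe State × List (Fin b)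
  step′ nothing  x = nothing , []
  step′ (just s) x = just (proj₁ (step s x)) , proj₂ (step s x)

  step′-bounded : ∀ s x → length (proj₂ (step′ s x)) ≤ maxOut
  step′-bounded nothing  x = z≤n
  step′-bounded (just s) x = step-bounded s x

  single-pass : MultiPass a b
  single-pass = record
    { Outer = Bool ; Inner = Maybe State ; outer-code = Bool-code ; inner-code = Maybe-code state-code
    ; outer₀ = true ; outerStep = λ _ _ → false ; innerStart = start ; innerStep = step′
    ; final = [] ; maxOut = maxOut ; innerStep-bounded = step′-bounded ; final-bounded = z≤n }

  open MultiPassOutput single-pass using (transduce; output′; output)

  transduce-nothing : ∀ v → transduce nothing v ≡ []
  transduce-nothing []      = refl
  transduce-nothing (x ∷ v) = transduce-nothing v

  transduce-just : ∀ s v → transduce (just s) v ≡ translate s v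
  transduce-just s []      = refl
  transduce-just s (x ∷ v) = cong (proj₂ (step s x) ++_) (transduce-just (proj₁ (step s x)) v)

  output′-false : ∀ v → output′ false v ≡ []
  output′-false []      = refl
  output′-false (x ∷ v) rewrite transduce-nothing (x ∷ v) = output′-false v

  output≡translate : ∀ w → output w ≡ translate state₀ w
  output≡translate []      = refl
  output≡translate (x ∷ v) rewrite transduce-nothing (x ∷ v) | output′-false v | transduce-just state₀ (x ∷ v) =
    trans (++-identityʳ _) (++-identityʳ _)

transducer-computable : ∀ {a b} (T : Transducer a b) → PolyTimeComputable (Transducer.translate T (Transducer.state₀ T))
transducer-computable T with multiPass-computable (SinglePass.single-pass T)
... | p , M , halts =
  p , M , λ w → subst (Run.HaltsWithin M (evalPoly p (length w)) w) (SinglePass.output≡translate T w) (halts w)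

-- Formulas and their codes

rename : {V W : Set} → (V → W) → Form V → Form W
rename f (var x)  = var (f x)
rename f ⊤f       = ⊤f
rename f ⊥f       = ⊥f
rename f (¬f φ)   = ¬f rename f φ
rename f (φ ∧f ψ) = rename f φ ∧f rename f ψ
rename f (φ ∨f ψ) = rename f φ ∨f rename f ψ
rename f (φ ⇒f ψ) = rename f φ ⇒f rename f ψ

encForm-rename : ∀ {V W : Set} (ev : W → List Sym) (f : V → W) φ → encForm ev (rename f φ) ≡ encForm (λ v → ev (f v)) φ
encForm-rename ev f (var x)  = refl
encForm-rename ev f ⊤f       = refl
encForm-rename ev f ⊥f       = refl
encForm-rename ev f (¬f φ)   = cong (sN ∷_) (encForm-rename ev f φ)
encForm-rename ev f (φ ∧f ψ) = cong₂ (λ u v → sA ∷ u ++ v) (encForm-rename ev f φ) (encForm-rename ev f ψ)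
encForm-rename ev f (φ ∨f ψ) = cong₂ (λ u v → sO ∷ u ++ v) (encForm-rename ev f φ) (encForm-rename ev f ψ)
encForm-rename ev f (φ ⇒f ψ) = cong₂ (λ u v → sM ∷ u ++ v) (encForm-rename ev f φ) (encForm-rename ev f ψ)

eval-rename : ∀ {V W : Set} (ρ : W → Bool) (f : V → W) φ → eval ρ (rename f φ) ≡ eval (λ v → ρ (f v)) φ
eval-rename ρ f (var x)  = refl
eval-rename ρ f ⊤f       = refl
eval-rename ρ f ⊥f       = refl
eval-rename ρ f (¬f φ)   = cong not (eval-rename ρ f φ)
eval-rename ρ f (φ ∧f ψ) = cong₂ _∧_ (eval-rename ρ f φ) (eval-rename ρ f ψ)
eval-rename ρ f (φ ∨f ψ) = cong₂ _∨_ (eval-rename ρ f φ) (eval-rename ρ f ψ)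
eval-rename ρ f (φ ⇒f ψ) = cong₂ (λ u v → not u ∨ v) (eval-rename ρ f φ) (eval-rename ρ f ψ)

maxVar-rename : ∀ {V W : Set} (ix : W → ℕ) (f : V → W) φ → maxVar ix (rename f φ) ≡ maxVar (λ v → ix (f v)) φ
maxVar-rename ix f (var x)  = refl
maxVar-rename ix f ⊤f       = refl
maxVar-rename ix f ⊥f       = refl
maxVar-rename ix f (¬f φ)   = maxVar-rename ix f φ
maxVar-rename ix f (φ ∧f ψ) = cong₂ _⊔_ (maxVar-rename ix f φ) (maxVar-rename ix f ψ)
maxVar-rename ix f (φ ∨f ψ) = cong₂ _⊔_ (maxVar-rename ix f φ) (maxVar-rename ix f ψ)
maxVar-rename ix f (φ ⇒f ψ) = cong₂ _⊔_ (maxVar-rename ix f φ) (maxVar-rename ix f ψ)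

eval-cong : ∀ {V : Set} {ρ ρ′ : V → Bool} → (∀ v → ρ v ≡ ρ′ v) → ∀ φ → eval ρ φ ≡ eval ρ′ φ
eval-cong h (var x)  = h x
eval-cong h ⊤f       = refl
eval-cong h ⊥f       = refl
eval-cong h (¬f φ)   = cong not (eval-cong h φ)
eval-cong h (φ ∧f ψ) = cong₂ _∧_ (eval-cong h φ) (eval-cong h ψ)
eval-cong h (φ ∨f ψ) = cong₂ _∨_ (eval-cong h φ) (eval-cong h ψ)
eval-cong h (φ ⇒f ψ) = cong₂ (λ u v → not u ∨ v) (eval-cong h φ) (eval-cong h ψ)

maxVar-cong : ∀ {V : Set} {ix ix′ : V → ℕ} → (∀ v → ix v ≡ ix′ v) → ∀ φ → maxVar ix φ ≡ maxVar ix′ φ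
maxVar-cong h (var x)  = h x
maxVar-cong h ⊤f       = refl
maxVar-cong h ⊥f       = refl
maxVar-cong h (¬f φ)   = maxVar-cong h φ
maxVar-cong h (φ ∧f ψ) = cong₂ _⊔_ (maxVar-cong h φ) (maxVar-cong h ψ)
maxVar-cong h (φ ∨f ψ) = cong₂ _⊔_ (maxVar-cong h φ) (maxVar-cong h ψ)
maxVar-cong h (φ ⇒f ψ) = cong₂ _⊔_ (maxVar-cong h φ) (maxVar-cong h ψ)

decodeSym : Fin 10 → Sym
decodeSym zero                                                       = sX
decodeSym (suc zero)                                                 = sY
decodeSym (suc (suc zero))                                           = sI
decodeSym (suc (suc (suc zero)))                                     = sT
decodeSym (suc (suc (suc (suc zero))))                               = sF
decodeSym (suc (suc (suc (suc (suc zero)))))                         = sN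
decodeSym (suc (suc (suc (suc (suc (suc zero))))))                   = sA
decodeSym (suc (suc (suc (suc (suc (suc (suc zero)))))))             = sO
decodeSym (suc (suc (suc (suc (suc (suc (suc (suc zero))))))))       = sM
decodeSym (suc (suc (suc (suc (suc (suc (suc (suc (suc zero))))))))) = sE

decodeSym-symCode : ∀ c → decodeSym (symCode c) ≡ c
decodeSym-symCode sX = refl
decodeSym-symCode sY = refl
decodeSym-symCode sI = refl
decodeSym-symCode sT = refl
decodeSym-symCode sF = refl
decodeSym-symCode sN = refl
decodeSym-symCode sA = refl
decodeSym-symCode sO = refl
decodeSym-symCode sM = refl
decodeSym-symCode sE = refl

symCode-injective : ∀ {c c′} → symCode c ≡ symCode c′ → c ≡ c′
symCode-injective {c} {c′} eq = trans (sym (decodeSym-symCode c)) (trans (cong decodeSym eq) (decodeSym-symCode c′))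

isI : Sym → Bool
isI sI = true
isI _  = false

-- the words that may follow a complete formula code without extending a variable tally
NoLeadingI : List Sym → Set
NoLeadingI []      = ⊤
NoLeadingI (c ∷ _) = isI c ≡ false

NoLeadingE : List Sym → Set
NoLeadingE []       = ⊤
NoLeadingE (sE ∷ _) = ⊥
NoLeadingE (_ ∷ _)  = ⊤

tally-unique : ∀ n n′ r r′ → NoLeadingI r → NoLeadingI r′ →
               replicate n sI ++ r ≡ replicate n′ sI ++ r′ → n ≡ n′ × r ≡ r′
tally-unique zero    zero     r        r′        _ _  eq = refl , eq
tally-unique zero    (suc n′) (sI ∷ r) r′        () _ refl
tally-unique (suc n) zero     r        (sI ∷ r′) _ () refl
tally-unique (suc n) (suc n′) r        r′        h h′ eq with tally-unique n n′ r r′ h h′ (∷-injectiveʳ eq)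
... | refl , e = refl , e

module Readability (m : ℕ) where

  encVar : ℕ ⊎ Fin m → List Sym
  encVar = [ encX , (λ j → encY (toℕ j)) ]

  enc : Form (ℕ ⊎ Fin m) → List Sym
  enc = encForm encVar

  enc-NoLeadingI : ∀ φ r → NoLeadingI (enc φ ++ r)
  enc-NoLeadingI (var (inj₁ _)) r = refl
  enc-NoLeadingI (var (inj₂ _)) r = refl
  enc-NoLeadingI ⊤f             r = refl
  enc-NoLeadingI ⊥f             r = refl
  enc-NoLeadingI (¬f _)         r = refl
  enc-NoLeadingI (_ ∧f _)       r = refl
  enc-NoLeadingI (_ ∨f _)       r = refl
  enc-NoLeadingI (_ ⇒f _)       r = refl

  enc-NoLeadingE : ∀ φ r → NoLeadingE (enc φ ++ r)
  enc-NoLeadingE (var (inj₁ _)) r = tt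
  enc-NoLeadingE (var (inj₂ _)) r = tt
  enc-NoLeadingE ⊤f             r = tt
  enc-NoLeadingE ⊥f             r = tt
  enc-NoLeadingE (¬f _)         r = tt
  enc-NoLeadingE (_ ∧f _)       r = tt
  enc-NoLeadingE (_ ∨f _)       r = tt
  enc-NoLeadingE (_ ⇒f _)       r = tt

  encVar-unique : ∀ v v′ r r′ → NoLeadingI r → NoLeadingI r′ →
                  encVar v ++ r ≡ encVar v′ ++ r′ → v ≡ v′ × r ≡ r′
  encVar-unique (inj₁ k) (inj₁ k′) r r′ h h′ eq with tally-unique (suc k) (suc k′) r r′ h h′ (∷-injectiveʳ eq)
  ... | refl , e = refl , e
  encVar-unique (inj₁ _) (inj₂ _) r r′ h h′ ()
  encVar-unique (inj₂ _) (inj₁ _) r r′ h h′ ()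
  encVar-unique (inj₂ j) (inj₂ j′) r r′ h h′ eq
    with tally-unique (suc (toℕ j)) (suc (toℕ j′)) r r′ h h′ (∷-injectiveʳ eq)
  ... | e₁ , e = cong inj₂ (toℕ-injective (suc-injective e₁)) , e

  enc-unique : ∀ φ ψ r r′ → NoLeadingI r → NoLeadingI r′ → enc φ ++ r ≡ enc ψ ++ r′ → φ ≡ ψ × r ≡ r′
  enc-unique₂ : ∀ c φ₁ φ₂ ψ₁ ψ₂ r r′ → NoLeadingI r → NoLeadingI r′ →
                (c ∷ enc φ₁ ++ enc φ₂) ++ r ≡ (c ∷ enc ψ₁ ++ enc ψ₂) ++ r′ → φ₁ ≡ ψ₁ × φ₂ ≡ ψ₂ × r ≡ r′
  enc-unique₂ c φ₁ φ₂ ψ₁ ψ₂ r r′ h h′ eq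
    with enc-unique φ₁ ψ₁ (enc φ₂ ++ r) (enc ψ₂ ++ r′) (enc-NoLeadingI φ₂ r) (enc-NoLeadingI ψ₂ r′)
           (trans (sym (++-assoc (enc φ₁) (enc φ₂) r)) (trans (∷-injectiveʳ eq) (++-assoc (enc ψ₁) (enc ψ₂) r′)))
  ... | refl , e with enc-unique φ₂ ψ₂ r r′ h h′ e
  ... | refl , e′ = refl , refl , e′

  enc-unique (var v) (var v′) r r′ h h′ eq with encVar-unique v v′ r r′ h h′ eq
  ... | refl , e = refl , e
  enc-unique (var (inj₁ _)) ⊤f         _ _ _ _ ()
  enc-unique (var (inj₁ _)) ⊥f         _ _ _ _ ()
  enc-unique (var (inj₁ _)) (¬f _)     _ _ _ _ ()
  enc-unique (var (inj₁ _)) (_ ∧f _)   _ _ _ _ ()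
  enc-unique (var (inj₁ _)) (_ ∨f _)   _ _ _ _ ()
  enc-unique (var (inj₁ _)) (_ ⇒f _)   _ _ _ _ ()
  enc-unique (var (inj₂ _)) ⊤f         _ _ _ _ ()
  enc-unique (var (inj₂ _)) ⊥f         _ _ _ _ ()
  enc-unique (var (inj₂ _)) (¬f _)     _ _ _ _ ()
  enc-unique (var (inj₂ _)) (_ ∧f _)   _ _ _ _ ()
  enc-unique (var (inj₂ _)) (_ ∨f _)   _ _ _ _ ()
  enc-unique (var (inj₂ _)) (_ ⇒f _)   _ _ _ _ ()
  enc-unique ⊤f       (var (inj₁ _)) _ _ _ _ ()
  enc-unique ⊥f       (var (inj₁ _)) _ _ _ _ ()
  enc-unique (¬f _)   (var (inj₁ _)) _ _ _ _ ()
  enc-unique (_ ∧f _) (var (inj₁ _)) _ _ _ _ ()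
  enc-unique (_ ∨f _) (var (inj₁ _)) _ _ _ _ ()
  enc-unique (_ ⇒f _) (var (inj₁ _)) _ _ _ _ ()
  enc-unique ⊤f       (var (inj₂ _)) _ _ _ _ ()
  enc-unique ⊥f       (var (inj₂ _)) _ _ _ _ ()
  enc-unique (¬f _)   (var (inj₂ _)) _ _ _ _ ()
  enc-unique (_ ∧f _) (var (inj₂ _)) _ _ _ _ ()
  enc-unique (_ ∨f _) (var (inj₂ _)) _ _ _ _ ()
  enc-unique (_ ⇒f _) (var (inj₂ _)) _ _ _ _ ()
  enc-unique ⊤f ⊤f r r′ h h′ eq = refl , ∷-injectiveʳ eq
  enc-unique ⊥f ⊥f r r′ h h′ eq = refl , ∷-injectiveʳ eq
  enc-unique (¬f φ) (¬f ψ) r r′ h h′ eq with enc-unique φ ψ r r′ h h′ (∷-injectiveʳ eq)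
  ... | refl , e = refl , e
  enc-unique (φ₁ ∧f φ₂) (ψ₁ ∧f ψ₂) r r′ h h′ eq with enc-unique₂ sA φ₁ φ₂ ψ₁ ψ₂ r r′ h h′ eq
  ... | refl , refl , e = refl , e
  enc-unique (φ₁ ∨f φ₂) (ψ₁ ∨f ψ₂) r r′ h h′ eq with enc-unique₂ sO φ₁ φ₂ ψ₁ ψ₂ r r′ h h′ eq
  ... | refl , refl , e = refl , e
  enc-unique (φ₁ ⇒f φ₂) (ψ₁ ⇒f ψ₂) r r′ h h′ eq with enc-unique₂ sM φ₁ φ₂ ψ₁ ψ₂ r r′ h h′ eq
  ... | refl , refl , e = refl , e

binder : ℕ → List Sym
binder j = sE ∷ encY j

binders : ℕ → List Sym
binders m = concatMap binder (upTo m)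

binders-unique : ∀ (f : ℕ → ℕ) n n′ B B′ → NoLeadingE B → NoLeadingE B′ →
  concatMap binder (applyUpTo f n) ++ B ≡ concatMap binder (applyUpTo f n′) ++ B′ → n ≡ n′ × B ≡ B′
binders-unique f zero    zero     B        B′        _ _  eq = refl , eq
binders-unique f zero    (suc n′) (sE ∷ B) B′        () _ refl
binders-unique f (suc n) zero     B        (sE ∷ B′) _ () refl
binders-unique f (suc n) (suc n′) B        B′        h h′ eq
  with binders-unique (λ i → f (suc i)) n n′ B B′ h h′
         (++-cancelˡ (binder (f zero)) _ _
           (trans (sym (++-assoc (binder (f zero)) _ B)) (trans eq (++-assoc (binder (f zero)) _ B′))))
... | refl , e = refl , e

codeEPF-injective : ∀ Φ Ψ → codeEPF Φ ≡ codeEPF Ψ → Φ ≡ Ψ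
codeEPF-injective (∃[ m ] φ) (∃[ m′ ] ψ) eq
  with binders-unique (λ i → i) m m′ _ _ (Readability.enc-NoLeadingE m φ []) (Readability.enc-NoLeadingE m′ ψ [])
         (trans (cong (binders m ++_) (++-identityʳ _))
                (trans (map-injective symCode-injective eq) (cong (binders m′ ++_) (sym (++-identityʳ _)))))
... | refl , e with Readability.enc-unique m φ ψ [] [] tt tt e
... | refl , _ = refl

-- Reductions, and part (1)

module _ (L₁ L₂ : LogicSystem) where
  open LogicSystem L₁ renaming (a to a₁; d to d₁; T to T₁; S to S₁; R to R₁)
  open LogicSystem L₂ renaming (a to a₂; d to d₂; T to T₂; S to S₂; R to R₂)

  ≼ptime-intro : (F : Word a₁ → Word a₂) (G : Word (suc (a₁ + d₁)) → Word d₂) →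
    PolyTimeComputable F → PolyTimeComputable G →
    (∀ t → T₁ t → T₂ (F t)) →
    (∀ t → T₁ t → ∀ v → S₁ v → R₁ t v → S₂ (G (pairEnc t v)) × R₂ (F t) (G (pairEnc t v))) →
    (∀ t → T₁ t → ∀ v v′ → R₁ t v → R₁ t v′ → G (pairEnc t v) ≡ G (pairEnc t v′) → v ≡ v′) →
    (∀ t → T₁ t → ∀ u → S₂ u → R₂ (F t) u →
       Σ (Word d₁) λ v → Σ (S₁ v) λ _ → R₁ t v × G (pairEnc t v) ≡ u) →
    L₁ ≼ptime L₂
  ≼ptime-intro F G (p , MF , F-halts) (q , MG , G-halts) T-pres sound inj surj =
    p , q , (λ t _ → F t) , (λ t _ v _ → G (pairEnc t v)) , T-pres ,
    (MF , λ t _ → F-halts t) , (MG , λ t _ v _ → G-halts (pairEnc t v)) ,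
    λ t h → sound t h , (λ v v′ _ _ → inj t h v v′) , surj t h

copying : ∀ a → Transducer a a
copying a = record
  { State = ⊤ ; state-code = ⊤-code ; state₀ = tt ; step = λ _ x → tt , x ∷ []
  ; maxOut = 1 ; step-bounded = λ _ _ → s≤s z≤n }

translate-copying : ∀ {a} (w : List (Fin a)) → Transducer.translate (copying a) tt w ≡ w
translate-copying []      = refl
translate-copying (x ∷ w) = cong (x ∷_) (translate-copying w)

module SecondComponent {a d b : ℕ} (h : Fin d → List (Fin b)) (k : ℕ) (h-bounded : ∀ y → length (h y) ≤ k) where

  emit : Fin a ⊎ Fin d → List (Fin b)
  emit (inj₁ _) = []
  emit (inj₂ y) = h y

  emit-bounded : ∀ i → length (emit i) ≤ k
  emit-bounded (inj₁ _) = z≤n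
  emit-bounded (inj₂ y) = h-bounded y

  step : Bool → Fin (suc (a + d)) → Bool × List (Fin b)
  step false zero    = true , []
  step false (suc _) = false , []
  step true  zero    = true , []
  step true  (suc i) = true , emit (splitAt a i)

  step-bounded : ∀ s x → length (proj₂ (step s x)) ≤ k
  step-bounded false zero    = z≤n
  step-bounded false (suc _) = z≤n
  step-bounded true  zero    = z≤n
  step-bounded true  (suc i) = emit-bounded (splitAt a i)

  secondComponent : Transducer (suc (a + d)) b
  secondComponent = record
    { State = Bool ; state-code = Bool-code ; state₀ = false ; step = step
    ; maxOut = k ; step-bounded = step-bounded }

  open Transducer secondComponent using (translate)

  translate-second : ∀ (t : List (Fin a)) w → translate false (pairEnc t w) ≡ concatMap h w
  translate-second []      w = after-separator w
    where
      after-separator : ∀ w → translate true (map (λ y → suc (a ↑ʳ y)) w) ≡ concatMap h w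
      after-separator []      = refl
      after-separator (y ∷ w) rewrite splitAt-↑ʳ a d y = cong (h y ++_) (after-separator w)
  translate-second (x ∷ t) w = translate-second t w

noBound : PForm → EForm
noBound φ = ∃[ 0 ] rename inj₁ φ

codeEPF-noBound : ∀ φ → codeEPF (noBound φ) ≡ codePF φ
codeEPF-noBound φ = cong (map symCode) (encForm-rename _ inj₁ φ)

IsModelEPF-noBound⁻ : ∀ φ w → IsModelEPF (noBound φ) w → IsModelPF φ w
IsModelEPF-noBound⁻ φ w (len , _ , ev) = trans len (maxVar-rename _ inj₁ φ) , trans (sym (eval-rename _ inj₁ φ)) ev

IsModelEPF-noBound⁺ : ∀ φ w → IsModelPF φ w → IsModelEPF (noBound φ) w
IsModelEPF-noBound⁺ φ w (len , ev) = trans len (sym (maxVar-rename _ inj₁ φ)) , (λ ()) , trans (eval-rename _ inj₁ φ) ev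

IsMinModelEPF-noBound⁻ : ∀ φ w → IsMinModelEPF (noBound φ) w → IsMinModelPF φ w
IsMinModelEPF-noBound⁻ φ w (mod , min) =
  IsModelEPF-noBound⁻ φ w mod , λ (w′ , mod′ , sub) → min (w′ , IsModelEPF-noBound⁺ φ w′ mod′ , sub)

IsMinModelEPF-noBound⁺ : ∀ φ w → IsMinModelPF φ w → IsMinModelEPF (noBound φ) w
IsMinModelEPF-noBound⁺ φ w (mod , min) =
  IsModelEPF-noBound⁺ φ w mod , λ (w′ , mod′ , sub) → min (w′ , IsModelEPF-noBound⁻ φ w′ mod′ , sub)

PF-MinSat≼EPF-FMinSat : LS-PF-MinSat ≼ptime LS-EPF-FMinSat
PF-MinSat≼EPF-FMinSat =
  ≼ptime-intro LS-PF-MinSat LS-EPF-FMinSat F G (transducer-computable (copying 10)) (transducer-computable second)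
    (λ t (φ , e) → noBound φ , code≡ φ e)
    (λ t _ v _ (φ , e , min) →
       tt , subst (FMinSat (F t)) (sym (G-pair t v)) (noBound φ , code≡ φ e , IsMinModelEPF-noBound⁺ φ v min))
    (λ t _ v v′ _ _ eq → trans (sym (G-pair t v)) (trans eq (G-pair t v′)))
    surj
  where
    open SecondComponent {10} {2} (λ y → y ∷ []) 1 (λ _ → s≤s z≤n) renaming (secondComponent to second)
    F : Word 10 → Word 10
    F = Transducer.translate (copying 10) tt
    G : Word 13 → Word 2
    G = Transducer.translate second false
    G-pair : ∀ t w → G (pairEnc t w) ≡ w
    G-pair t w = trans (translate-second t w) (concatMap-pure w)
    code≡ : ∀ {t} φ → codePF φ ≡ t → codeEPF (noBound φ) ≡ F t
    code≡ {t} φ e = trans (codeEPF-noBound φ) (trans e (sym (translate-copying t)))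
    surj : ∀ t → PF t → ∀ u → TA u → FMinSat (F t) u →
           Σ (Word 2) λ v → Σ (TA v) λ _ → MinSat t v × G (pairEnc t v) ≡ u
    surj t (φ , e) u _ (Φ , eΦ , min) with codeEPF-injective Φ (noBound φ) (trans eΦ (sym (code≡ φ e)))
    ... | refl = u , tt , (φ , e , IsMinModelEPF-noBound⁻ φ u min) , G-pair t u

-- Pairing the free variables

double : ℕ → ℕ
double zero    = zero
double (suc k) = suc (suc (double k))

double-⊔ : ∀ m n → double (m ⊔ n) ≡ double m ⊔ double n
double-⊔ zero    n       = refl
double-⊔ (suc m) zero    = refl
double-⊔ (suc m) (suc n) = cong (λ x → suc (suc x)) (double-⊔ m n)

double-mono : ∀ {m n} → m ≤ n → double m ≤ double n
double-mono z≤n       = z≤n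
double-mono (s≤s m≤n) = s≤s (s≤s (double-mono m≤n))

maxVar-double : ∀ {V : Set} (ix : V → ℕ) φ → maxVar (λ v → double (ix v)) φ ≡ double (maxVar ix φ)
maxVar-double ix (var x)  = refl
maxVar-double ix ⊤f       = refl
maxVar-double ix ⊥f       = refl
maxVar-double ix (¬f φ)   = maxVar-double ix φ
maxVar-double ix (φ ∧f ψ) =
  trans (cong₂ _⊔_ (maxVar-double ix φ) (maxVar-double ix ψ)) (sym (double-⊔ (maxVar ix φ) (maxVar ix ψ)))
maxVar-double ix (φ ∨f ψ) =
  trans (cong₂ _⊔_ (maxVar-double ix φ) (maxVar-double ix ψ)) (sym (double-⊔ (maxVar ix φ) (maxVar ix ψ)))
maxVar-double ix (φ ⇒f ψ) =
  trans (cong₂ _⊔_ (maxVar-double ix φ) (maxVar-double ix ψ)) (sym (double-⊔ (maxVar ix φ) (maxVar ix ψ)))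

<-⊔-split : ∀ {r} m n → r < m ⊔ n → r < m ⊎ r < n
<-⊔-split m n r< with ⊔-sel m n
... | inj₁ eq = inj₁ (subst (_ <_) eq r<)
... | inj₂ eq = inj₂ (subst (_ <_) eq r<)

foldl-∧f-true⁻ : ∀ {V : Set} (ρ : V → Bool) es ψ → eval ρ (foldl _∧f_ ψ es) ≡ true →
                 eval ρ ψ ≡ true × All (λ e → eval ρ e ≡ true) es
foldl-∧f-true⁻ ρ []       ψ h = h , []
foldl-∧f-true⁻ ρ (e ∷ es) ψ h with foldl-∧f-true⁻ ρ es (ψ ∧f e) h
... | ψ∧e , es-true = ∧-conicalˡ _ _ ψ∧e , ∧-conicalʳ _ _ ψ∧e ∷ es-true

foldl-∧f-true⁺ : ∀ {V : Set} (ρ : V → Bool) es ψ → eval ρ ψ ≡ true → All (λ e → eval ρ e ≡ true) es →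
                 eval ρ (foldl _∧f_ ψ es) ≡ true
foldl-∧f-true⁺ ρ []       ψ h []          = h
foldl-∧f-true⁺ ρ (e ∷ es) ψ h (he ∷ es-true) = foldl-∧f-true⁺ ρ es (ψ ∧f e) (cong₂ _∧_ h he) es-true

maxVar-foldl-∧f : ∀ {V : Set} (ix : V → ℕ) es ψ → All (λ e → maxVar ix e ≤ maxVar ix ψ) es →
                  maxVar ix (foldl _∧f_ ψ es) ≡ maxVar ix ψ
maxVar-foldl-∧f ix []       ψ []          = refl
maxVar-foldl-∧f ix (e ∷ es) ψ (e≤ψ ∷ es≤ψ) =
  trans (maxVar-foldl-∧f ix es (ψ ∧f e) (All.map (subst (_ ≤_) (sym ψ∧e≡ψ)) es≤ψ)) ψ∧e≡ψ
  where
    ψ∧e≡ψ : maxVar ix (ψ ∧f e) ≡ maxVar ix ψ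
    ψ∧e≡ψ = m≥n⇒m⊔n≡m e≤ψ

flipBit : Fin 2 → Fin 2
flipBit zero    = suc zero
flipBit (suc _) = zero

interleave : Word 2 → Word 2
interleave = concatMap (λ y → flipBit y ∷ y ∷ [])

uninterleave : Word 2 → Word 2
uninterleave []          = []
uninterleave (_ ∷ [])    = []
uninterleave (_ ∷ y ∷ w) = y ∷ uninterleave w

uninterleave-interleave : ∀ w → uninterleave (interleave w) ≡ w
uninterleave-interleave []      = refl
uninterleave-interleave (y ∷ w) = cong (y ∷_) (uninterleave-interleave w)

length-interleave : ∀ w → length (interleave w) ≡ double (length w)
length-interleave []      = refl
length-interleave (y ∷ w) = cong (λ n → suc (suc n)) (length-interleave w)

bit-∷-∷ : ∀ (x y : Fin 2) w k → bit (x ∷ y ∷ w) (suc (suc k)) ≡ bit w k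
bit-∷-∷ zero    zero    w k = refl
bit-∷-∷ zero    (suc _) w k = refl
bit-∷-∷ (suc _) zero    w k = refl
bit-∷-∷ (suc _) (suc _) w k = refl

bit-interleave-odd : ∀ w k → bit (interleave w) (suc (double k)) ≡ bit w k
bit-interleave-odd []            k       = refl
bit-interleave-odd (zero ∷ w)    zero    = refl
bit-interleave-odd (suc _ ∷ w)   zero    = refl
bit-interleave-odd (zero ∷ w)    (suc k) = bit-interleave-odd w k
bit-interleave-odd (suc _ ∷ w)   (suc k) = bit-interleave-odd w k

bit-interleave-even : ∀ w k → k < length w → bit (interleave w) (double k) ≡ not (bit w k)
bit-interleave-even (zero ∷ w)       zero    _       = refl
bit-interleave-even (suc zero ∷ w)   zero    _       = refl
bit-interleave-even (zero ∷ w)       (suc k) (s≤s h) = bit-interleave-even w k h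
bit-interleave-even (suc _ ∷ w)      (suc k) (s≤s h) = bit-interleave-even w k h

-- x ≤ y together with ¬x ≤ ¬y forces x = y
interleave-SubAssign : ∀ v w → SubAssign (interleave v) (interleave w) → v ≡ w
interleave-SubAssign []      []      []            = refl
interleave-SubAssign (x ∷ v) (y ∷ w) (¬x≤¬y ∷ x≤y ∷ v≤w) =
  cong₂ _∷_ (same ¬x≤¬y x≤y) (interleave-SubAssign v w v≤w)
  where
    same : ∀ {x y : Fin 2} → flipBit x Fin.≤ flipBit y → x Fin.≤ y → x ≡ y
    same {zero}     {zero}     _  _  = refl
    same {zero}     {suc zero} () _
    same {suc zero} {zero}     _  ()
    same {suc zero} {suc zero} _  _  = refl

≡-interleave : ∀ n u → length u ≡ double n →
  (∀ r → r < n → bit u (suc (double r)) ≡ not (bit u (double r))) → u ≡ interleave (uninterleave u)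
≡-interleave zero    []          _   _ = refl
≡-interleave (suc n) (x ∷ y ∷ u) len h =
  cong₂ _∷_ (complementary x y (h zero (s≤s z≤n)))
    (cong (y ∷_) (≡-interleave n u (suc-injective (suc-injective len))
      (λ r r<n → trans (sym (bit-∷-∷ x y u (suc (double r))))
                       (trans (h (suc r) (s≤s r<n)) (cong not (bit-∷-∷ x y u (double r)))))))
  where
    complementary : ∀ (x y : Fin 2) → bit (x ∷ y ∷ u) 1 ≡ not (bit (x ∷ y ∷ u) 0) → x ≡ flipBit y
    complementary zero       zero       ()
    complementary zero       (suc zero) _ = refl
    complementary (suc zero) zero       _ = refl
    complementary (suc zero) (suc zero) ()

length-uninterleave : ∀ n u → length u ≡ double n → length (uninterleave u) ≡ n
length-uninterleave zero    []          _   = refl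
length-uninterleave (suc n) (x ∷ y ∷ u) len = cong suc (length-uninterleave n u (suc-injective (suc-injective len)))

module Pairing (m : ℕ) where

  V : Set
  V = ℕ ⊎ Fin m

  ix : V → ℕ
  ix = [ suc , (λ _ → 0) ]

  -- var k is x_{k+1}; the free variable x_{k+1} of φ becomes x_{2k+2}, and
  -- complement r says that x_{2r+1} is the negation of x_{2r+2}
  shift : V → V
  shift (inj₁ k) = inj₁ (suc (double k))
  shift (inj₂ j) = inj₂ j

  complement : ℕ → Form V
  complement r = ((¬f var (inj₁ (double r))) ⇒f var (inj₁ (suc (double r)))) ∧f
                 (var (inj₁ (double r)) ⇒f (¬f var (inj₁ (suc (double r)))))

  -- Each occurrence of x_{k+1} contributes the constraints for x_1 … x_{k+1}:
  -- together they cover all free variables, and a finite-state device can emit them.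
  indices : Form V → List ℕ
  indices (var (inj₁ k)) = downFrom (suc k)
  indices (var (inj₂ _)) = []
  indices ⊤f             = []
  indices ⊥f             = []
  indices (¬f φ)         = indices φ
  indices (φ ∧f ψ)       = indices φ ++ indices ψ
  indices (φ ∨f ψ)       = indices φ ++ indices ψ
  indices (φ ⇒f ψ)       = indices φ ++ indices ψ

  constraints : Form V → List (Form V)
  constraints φ = map complement (indices φ)

  paired : Form V → Form V
  paired φ = foldl _∧f_ (rename shift φ) (constraints φ)

  indices-bounded : ∀ φ → All (_< maxVar ix φ) (indices φ)
  indices-bounded (var (inj₁ k)) = All.tabulate ∈-downFrom⁻
  indices-bounded (var (inj₂ _)) = []
  indices-bounded ⊤f             = []
  indices-bounded ⊥f             = []
  indices-bounded (¬f φ)         = indices-bounded φ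
  indices-bounded (φ ∧f ψ)       =
    ++⁺ (All.map (m≤n⇒m≤n⊔o _) (indices-bounded φ)) (All.map (m≤n⇒m≤o⊔n _) (indices-bounded ψ))
  indices-bounded (φ ∨f ψ)       =
    ++⁺ (All.map (m≤n⇒m≤n⊔o _) (indices-bounded φ)) (All.map (m≤n⇒m≤o⊔n _) (indices-bounded ψ))
  indices-bounded (φ ⇒f ψ)       =
    ++⁺ (All.map (m≤n⇒m≤n⊔o _) (indices-bounded φ)) (All.map (m≤n⇒m≤o⊔n _) (indices-bounded ψ))

  indices-complete : ∀ φ {r} → r < maxVar ix φ → r ∈ indices φ
  indices-complete₂ : ∀ φ ψ {r} → r < maxVar ix φ ⊔ maxVar ix ψ → r ∈ indices φ ++ indices ψ
  indices-complete₂ φ ψ r< with <-⊔-split (maxVar ix φ) (maxVar ix ψ) r<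
  ... | inj₁ r<φ = ∈-++⁺ˡ (indices-complete φ r<φ)
  ... | inj₂ r<ψ = ∈-++⁺ʳ (indices φ) (indices-complete ψ r<ψ)
  indices-complete (var (inj₁ k)) r< = ∈-downFrom⁺ r<
  indices-complete (¬f φ)         r< = indices-complete φ r<
  indices-complete (φ ∧f ψ)       r< = indices-complete₂ φ ψ r<
  indices-complete (φ ∨f ψ)       r< = indices-complete₂ φ ψ r<
  indices-complete (φ ⇒f ψ)       r< = indices-complete₂ φ ψ r<

  maxVar-shift : ∀ φ → maxVar ix (rename shift φ) ≡ double (maxVar ix φ)
  maxVar-shift φ = trans (maxVar-rename ix shift φ) (trans (maxVar-cong ix-shift φ) (maxVar-double ix φ))
    where
      ix-shift : ∀ v → ix (shift v) ≡ double (ix v)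
      ix-shift (inj₁ k) = refl
      ix-shift (inj₂ j) = refl

  maxVar-complement : ∀ r → maxVar ix (complement r) ≤ double (suc r)
  maxVar-complement r = ⊔-lub bound bound
    where
      bound : suc (double r) ⊔ suc (suc (double r)) ≤ suc (suc (double r))
      bound = ⊔-lub (n≤1+n _) ≤-refl

  maxVar-paired : ∀ φ → maxVar ix (paired φ) ≡ double (maxVar ix φ)
  maxVar-paired φ =
    trans (maxVar-foldl-∧f ix (constraints φ) (rename shift φ) (map⁺ (All.map bounded (indices-bounded φ))))
          (maxVar-shift φ)
    where
      bounded : ∀ {r} → r < maxVar ix φ → maxVar ix (complement r) ≤ maxVar ix (rename shift φ)
      bounded r< = ≤-trans (maxVar-complement _) (subst (_ ≤_) (sym (maxVar-shift φ)) (double-mono r<))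

  eval-complement⁻ : ∀ (ρ : V → Bool) r → eval ρ (complement r) ≡ true →
                     ρ (inj₁ (suc (double r))) ≡ not (ρ (inj₁ (double r)))
  eval-complement⁻ ρ r h with ρ (inj₁ (double r)) | ρ (inj₁ (suc (double r)))
  ... | false | true  = refl
  ... | true  | false = refl
  ... | false | false = h
  ... | true  | true  = sym h

  eval-complement⁺ : ∀ (ρ : V → Bool) r → ρ (inj₁ (suc (double r))) ≡ not (ρ (inj₁ (double r))) →
                     eval ρ (complement r) ≡ true
  eval-complement⁺ ρ r h with ρ (inj₁ (double r)) | ρ (inj₁ (suc (double r)))
  ... | false | true  = refl
  ... | true  | false = refl
  ... | false | false = h
  ... | true  | true  = sym h

  eval-shift : ∀ (ρ : ℕ → Bool) (τ : Fin m → Bool) φ →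
               eval [ ρ , τ ] (rename shift φ) ≡ eval [ (λ k → ρ (suc (double k))) , τ ] φ
  eval-shift ρ τ φ = trans (eval-rename [ ρ , τ ] shift φ) (eval-cong pointwise φ)
    where
      pointwise : ∀ v → [ ρ , τ ] (shift v) ≡ [ (λ k → ρ (suc (double k))) , τ ] v
      pointwise (inj₁ k) = refl
      pointwise (inj₂ j) = refl

  IsModelEPF-paired⁺ : ∀ φ v → IsModelEPF (∃[ m ] φ) v → IsModelEPF (∃[ m ] paired φ) (interleave v)
  IsModelEPF-paired⁺ φ v (len , τ , true-φ) =
    trans (length-interleave v) (trans (cong double len) (sym (maxVar-paired φ))) , τ ,
    foldl-∧f-true⁺ ρ (constraints φ) (rename shift φ)
      (trans (eval-shift (bit (interleave v)) τ φ) (trans (eval-cong odd-bits φ) true-φ))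
      (map⁺ (All.map complement-holds (indices-bounded φ)))
    where
      ρ = [ bit (interleave v) , τ ]
      odd-bits : ∀ x → [ (λ k → bit (interleave v) (suc (double k))) , τ ] x ≡ [ bit v , τ ] x
      odd-bits (inj₁ k) = bit-interleave-odd v k
      odd-bits (inj₂ j) = refl
      complement-holds : ∀ {r} → r < maxVar ix φ → eval ρ (complement r) ≡ true
      complement-holds {r} r< = eval-complement⁺ ρ r
        (trans (bit-interleave-odd v r)
               (trans (sym (not-involutive (bit v r)))
                      (cong not (sym (bit-interleave-even v r (subst (r <_) (sym len) r<))))))

  IsModelEPF-paired⁻ : ∀ φ u → IsModelEPF (∃[ m ] paired φ) u →
                       (u ≡ interleave (uninterleave u)) × IsModelEPF (∃[ m ] φ) (uninterleave u)
  IsModelEPF-paired⁻ φ u (len , τ , true-paired) =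
    u≡ , length-uninterleave n u len′ , τ , trans (sym (eval-cong odd-bits φ)) true-φ
    where
      n = maxVar ix φ
      len′ : length u ≡ double n
      len′ = trans len (maxVar-paired φ)
      parts : eval [ bit u , τ ] (rename shift φ) ≡ true × All (λ e → eval [ bit u , τ ] e ≡ true) (constraints φ)
      parts = foldl-∧f-true⁻ [ bit u , τ ] (constraints φ) (rename shift φ) true-paired
      u≡ : u ≡ interleave (uninterleave u)
      u≡ = ≡-interleave n u len′ λ r r< →
        eval-complement⁻ [ bit u , τ ] r (All.lookup (map⁻ (proj₂ parts)) (indices-complete φ r<))
      true-φ : eval [ (λ k → bit u (suc (double k))) , τ ] φ ≡ true
      true-φ = trans (sym (eval-shift (bit u) τ φ)) (proj₁ parts)
      odd-bits : ∀ x → [ (λ k → bit u (suc (double k))) , τ ] x ≡ [ bit (uninterleave u) , τ ] x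
      odd-bits (inj₁ k) = trans (cong (λ w → bit w (suc (double k))) u≡) (bit-interleave-odd (uninterleave u) k)
      odd-bits (inj₂ j) = refl

  -- every model of paired φ is an interleaving, and interleavings are pairwise incomparable
  IsMinModelEPF-paired : ∀ φ v → IsModelEPF (∃[ m ] φ) v → IsMinModelEPF (∃[ m ] paired φ) (interleave v)
  IsMinModelEPF-paired φ v mod =
    IsModelEPF-paired⁺ φ v mod , λ (w , mod-w , w≤v , w≢v) → w≢v (below w mod-w w≤v)
    where
      below : ∀ w → IsModelEPF (∃[ m ] paired φ) w → SubAssign w (interleave v) → w ≡ interleave v
      below w mod-w w≤v with IsModelEPF-paired⁻ φ w mod-w
      ... | w≡ , _ = trans w≡ (cong interleave
                       (interleave-SubAssign (uninterleave w) v (subst (λ z → SubAssign z (interleave v)) w≡ w≤v)))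

-- Computing the paired formula, and part (2)

module PairingTransducer where

  data Kind : Set where
    Prefix PrefixE Body BodyX Piece PieceI Stop : Kind

  data Position : Set where
    Initial Neutral InXTally : Position

  inPass0 : Fin 4 → List Sym → List Sym
  inPass0 zero    l = l
  inPass0 (suc _) l = []

  inPass1 : Fin 4 → List Sym → List Sym
  inPass1 (suc zero) l = l
  inPass1 _          l = []

  -- Over the formula body, pass 0 emits one A per tally I of a free variable,
  -- one for each conjunct added by paired, and pass 1 copies the body with
  -- free-variable tallies doubled, which is rename shift.
  plainStep : Fin 4 → Sym → Kind × List Sym
  plainStep p sX = BodyX , inPass1 p (sX ∷ [])
  plainStep p c  = Body , inPass1 p (c ∷ [])

  tallyStep : Fin 4 → Sym → Kind × List Sym
  tallyStep p c = if isI c then (BodyX , tallyOut p) else plainStep p c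
    where
      tallyOut : Fin 4 → List Sym
      tallyOut zero       = sA ∷ []
      tallyOut (suc zero) = sI ∷ sI ∷ []
      tallyOut _          = []

  -- The code of complement r, split into four pieces, one per pass, each to be
  -- followed by 2r tally I's.
  piece : Fin 4 → List Sym
  piece zero                   = sA ∷ sM ∷ sN ∷ sX ∷ sI ∷ []
  piece (suc zero)             = sX ∷ sI ∷ sI ∷ []
  piece (suc (suc zero))       = sM ∷ sX ∷ sI ∷ []
  piece (suc (suc (suc zero))) = sN ∷ sX ∷ sI ∷ sI ∷ []

  kindStep : Kind → Fin 4 → Sym → Kind × List Sym
  kindStep Prefix  p sI = Prefix , inPass0 p (sI ∷ [])
  kindStep Prefix  p sE = PrefixE , inPass0 p (sE ∷ [])
  kindStep Prefix  p c  = plainStep p c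
  kindStep PrefixE p sY = Prefix , inPass0 p (sY ∷ [])
  kindStep PrefixE p c  = Stop , []
  kindStep Body    p c  = plainStep p c
  kindStep BodyX   p c  = tallyStep p c
  kindStep Piece   p c  = if isI c then (PieceI , piece p) else (Stop , [])
  kindStep PieceI  p c  = if isI c then (PieceI , sI ∷ sI ∷ []) else (Stop , [])
  kindStep Stop    p c  = Stop , []

  Inner : Set
  Inner = Kind × Fin 4

  innerStep : Inner → Sym → Inner × List Sym
  innerStep (k , p) c = (proj₁ (kindStep k p c) , p) , proj₂ (kindStep k p c)

  -- At the first position passes 0 and 1 produce everything but the
  -- constraints; at a free-variable tally I followed by r more I's, the four
  -- passes emit the code of complement r.
  innerStart : Position → Fin 4 → Inner
  innerStart Initial  zero       = Prefix , zero
  innerStart Initial  (suc zero) = Prefix , suc zero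
  innerStart Initial  p          = Stop , p
  innerStart Neutral  p          = Stop , p
  innerStart InXTally p          = Piece , p

  leave : Sym → Position
  leave sX = InXTally
  leave _  = Neutral

  outerStep : Position → Sym → Position
  outerStep InXTally c = if isI c then InXTally else leave c
  outerStep _        c = leave c

  open PassOutput outerStep innerStart innerStep []

  transduce-Stop : ∀ p cs → transduce (Stop , p) cs ≡ []
  transduce-Stop p []       = refl
  transduce-Stop p (c ∷ cs) = transduce-Stop p cs

  passes-Neutral : ∀ v → passes Neutral v ≡ []
  passes-Neutral v
    rewrite transduce-Stop zero v | transduce-Stop (suc zero) v | transduce-Stop (suc (suc zero)) v
          | transduce-Stop (suc (suc (suc zero))) v = refl

  transduce-Piece-end : ∀ p r → NoLeadingI r → transduce (Piece , p) r ≡ []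
  transduce-Piece-end p []      _ = refl
  transduce-Piece-end p (c ∷ r) h rewrite h = transduce-Stop p r

  transduce-PieceI-end : ∀ p r → NoLeadingI r → transduce (PieceI , p) r ≡ []
  transduce-PieceI-end p []      _ = refl
  transduce-PieceI-end p (c ∷ r) h rewrite h = transduce-Stop p r

  transduce-PieceI-tally : ∀ p k r → NoLeadingI r → transduce (PieceI , p) (replicate k sI ++ r) ≡ replicate (double k) sI
  transduce-PieceI-tally p zero    r h = transduce-PieceI-end p r h
  transduce-PieceI-tally p (suc k) r h = cong (λ l → sI ∷ sI ∷ l) (transduce-PieceI-tally p k r h)

  output′-InXTally-end : ∀ r → NoLeadingI r → output′ InXTally r ≡ output′ Neutral r
  output′-InXTally-end []      _ = refl
  output′-InXTally-end (c ∷ r) h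
    rewrite transduce-Piece-end zero (c ∷ r) h | transduce-Piece-end (suc zero) (c ∷ r) h
          | transduce-Piece-end (suc (suc zero)) (c ∷ r) h | transduce-Piece-end (suc (suc (suc zero))) (c ∷ r) h
          | passes-Neutral (c ∷ r) | h = refl

  output′-Neutral-tally : ∀ n r → output′ Neutral (replicate n sI ++ r) ≡ output′ Neutral r
  output′-Neutral-tally zero    r = refl
  output′-Neutral-tally (suc n) r rewrite passes-Neutral (sI ∷ replicate n sI ++ r) = output′-Neutral-tally n r

  output′-Initial : ∀ u → output′ Initial u ≡ passes Initial u ++ output′ Neutral u
  output′-Initial []      = refl
  output′-Initial (c ∷ u) rewrite passes-Neutral (c ∷ u) = refl

  module PairingOutput (m : ℕ) where
    open Readability m
    open Pairing m

    passes-tally : ∀ k r → NoLeadingI r → passes InXTally (sI ∷ replicate k sI ++ r) ≡ enc (complement k)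
    passes-tally k r h
      rewrite transduce-PieceI-tally zero k r h | transduce-PieceI-tally (suc zero) k r h
            | transduce-PieceI-tally (suc (suc zero)) k r h | transduce-PieceI-tally (suc (suc (suc zero))) k r h =
      cong (λ l → sA ∷ sM ∷ sN ∷ sX ∷ sI ∷ l)
           (sym (++-assoc I₂ₖ (sX ∷ sI ∷ sI ∷ I₂ₖ) (sM ∷ sX ∷ sI ∷ I₂ₖ ++ sN ∷ sX ∷ sI ∷ sI ∷ I₂ₖ)))
      where
        I₂ₖ = replicate (double k) sI

    output′-tally : ∀ k r → NoLeadingI r →
      output′ InXTally (replicate (suc k) sI ++ r) ≡ concatMap enc (map complement (downFrom (suc k))) ++ output′ Neutral r
    output′-tally zero    r h =
      trans (cong₂ _++_ (passes-tally zero r h) (output′-InXTally-end r h))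
            (cong (_++ output′ Neutral r) (sym (++-identityʳ (enc (complement zero)))))
    output′-tally (suc k) r h =
      trans (cong₂ _++_ (passes-tally (suc k) r h) (output′-tally k r h))
            (sym (++-assoc (enc (complement (suc k))) (concatMap enc (map complement (downFrom (suc k)))) (output′ Neutral r)))

    concatMap-constraints : ∀ φ ψ → concatMap enc (map complement (indices φ ++ indices ψ)) ≡
                                    concatMap enc (constraints φ) ++ concatMap enc (constraints ψ)
    concatMap-constraints φ ψ =
      trans (cong (concatMap enc) (map-++ complement (indices φ) (indices ψ))) (concatMap-++ enc (constraints φ) (constraints ψ))

    -- positions other than the first contribute the constraint codes, in order
    output′-enc : ∀ φ r → NoLeadingI r →
                  output′ Neutral (enc φ ++ r) ≡ concatMap enc (constraints φ) ++ output′ Neutral r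
    output′-enc₂ : ∀ c φ ψ r → NoLeadingI r → outerStep Neutral c ≡ Neutral →
      output′ Neutral ((c ∷ enc φ ++ enc ψ) ++ r) ≡
        concatMap enc (map complement (indices φ ++ indices ψ)) ++ output′ Neutral r
    output′-enc₂ c φ ψ r h step≡ =
      begin
        output′ Neutral ((c ∷ enc φ ++ enc ψ) ++ r)
      ≡⟨ cong₂ _++_ (passes-Neutral (c ∷ (enc φ ++ enc ψ) ++ r))
                    (cong (λ q → output′ q ((enc φ ++ enc ψ) ++ r)) step≡) ⟩
        output′ Neutral ((enc φ ++ enc ψ) ++ r)
      ≡⟨ cong (output′ Neutral) (++-assoc (enc φ) (enc ψ) r) ⟩
        output′ Neutral (enc φ ++ enc ψ ++ r)
      ≡⟨ output′-enc φ (enc ψ ++ r) (enc-NoLeadingI ψ r) ⟩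
        concatMap enc (constraints φ) ++ output′ Neutral (enc ψ ++ r)
      ≡⟨ cong (concatMap enc (constraints φ) ++_) (output′-enc ψ r h) ⟩
        concatMap enc (constraints φ) ++ concatMap enc (constraints ψ) ++ output′ Neutral r
      ≡⟨ sym (++-assoc (concatMap enc (constraints φ)) _ _) ⟩
        (concatMap enc (constraints φ) ++ concatMap enc (constraints ψ)) ++ output′ Neutral r
      ≡⟨ cong (_++ output′ Neutral r) (sym (concatMap-constraints φ ψ)) ⟩
        concatMap enc (map complement (indices φ ++ indices ψ)) ++ output′ Neutral r
      ∎
      where open ≡-Reasoning
    output′-enc (var (inj₁ k)) r h =
      trans (cong (_++ output′ InXTally (replicate (suc k) sI ++ r)) (passes-Neutral (sX ∷ replicate (suc k) sI ++ r)))
            (output′-tally k r h)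
    output′-enc (var (inj₂ j)) r h =
      trans (cong (_++ output′ Neutral (replicate (suc (toℕ j)) sI ++ r))
                  (passes-Neutral (sY ∷ replicate (suc (toℕ j)) sI ++ r)))
            (output′-Neutral-tally (suc (toℕ j)) r)
    output′-enc ⊤f       r h = cong (_++ output′ Neutral r) (passes-Neutral (sT ∷ r))
    output′-enc ⊥f       r h = cong (_++ output′ Neutral r) (passes-Neutral (sF ∷ r))
    output′-enc (¬f φ)   r h =
      trans (cong (_++ output′ Neutral (enc φ ++ r)) (passes-Neutral (sN ∷ enc φ ++ r))) (output′-enc φ r h)
    output′-enc (φ ∧f ψ) r h = output′-enc₂ sA φ ψ r h refl
    output′-enc (φ ∨f ψ) r h = output′-enc₂ sO φ ψ r h refl
    output′-enc (φ ⇒f ψ) r h = output′-enc₂ sM φ ψ r h refl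

    output′-binders : ∀ (f : ℕ → ℕ) n B → output′ Neutral (concatMap binder (applyUpTo f n) ++ B) ≡ output′ Neutral B
    output′-binders f zero    B = refl
    output′-binders f (suc n) B =
      trans (cong (output′ Neutral) (++-assoc (binder (f zero)) (concatMap binder (applyUpTo (λ i → f (suc i)) n)) B))
      (trans (cong (_++ output′ Neutral (sY ∷ tally)) (passes-Neutral (sE ∷ sY ∷ tally)))
      (trans (cong (_++ output′ Neutral tally) (passes-Neutral (sY ∷ tally)))
      (trans (output′-Neutral-tally (suc (f zero)) Rest) (output′-binders (λ i → f (suc i)) n B))))
      where
        Rest  = concatMap binder (applyUpTo (λ i → f (suc i)) n) ++ B
        tally = replicate (suc (f zero)) sI ++ Rest

    transduce-Body-tally₀ : ∀ n r → transduce (Body , zero) (replicate n sI ++ r) ≡ transduce (Body , zero) r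
    transduce-Body-tally₀ zero    r = refl
    transduce-Body-tally₀ (suc n) r = transduce-Body-tally₀ n r

    transduce-BodyX-tally₀ : ∀ n r → transduce (BodyX , zero) (replicate n sI ++ r)
      ≡ replicate n sA ++ transduce (BodyX , zero) r
    transduce-BodyX-tally₀ zero    r = refl
    transduce-BodyX-tally₀ (suc n) r = cong (sA ∷_) (transduce-BodyX-tally₀ n r)

    transduce-Body-tally₁ : ∀ n r → transduce (Body , suc zero) (replicate n sI ++ r)
      ≡ replicate n sI ++ transduce (Body , suc zero) r
    transduce-Body-tally₁ zero    r = refl
    transduce-Body-tally₁ (suc n) r = cong (sI ∷_) (transduce-Body-tally₁ n r)

    transduce-BodyX-tally₁ : ∀ n r → transduce (BodyX , suc zero) (replicate n sI ++ r)
      ≡ replicate (double n) sI ++ transduce (BodyX , suc zero) r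
    transduce-BodyX-tally₁ zero    r = refl
    transduce-BodyX-tally₁ (suc n) r = cong (λ l → sI ∷ sI ∷ l) (transduce-BodyX-tally₁ n r)

    transduce-BodyX-end : ∀ p r → NoLeadingI r → transduce (BodyX , p) r ≡ transduce (Body , p) r
    transduce-BodyX-end p []      _ = refl
    transduce-BodyX-end p (c ∷ r) h rewrite h = refl

    replicate-+ : ∀ {A : Set} m n (x : A) → replicate (m + n) x ≡ replicate m x ++ replicate n x
    replicate-+ zero    n x = refl
    replicate-+ (suc m) n x = cong (x ∷_) (replicate-+ m n x)

    length-constraints : ∀ φ ψ → length (map complement (indices φ ++ indices ψ))
      ≡ length (constraints φ) + length (constraints ψ)
    length-constraints φ ψ = trans (cong length (map-++ complement (indices φ) (indices ψ))) (length-++ (constraints φ))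

    pass₀-body : ∀ φ r → NoLeadingI r → transduce (Body , zero) (enc φ ++ r)
      ≡ replicate (length (constraints φ)) sA ++ transduce (Body , zero) r
    pass₀-body₂ : ∀ c φ ψ r → NoLeadingI r →
      transduce (Body , zero) ((c ∷ enc φ ++ enc ψ) ++ r) ≡ transduce (Body , zero) ((enc φ ++ enc ψ) ++ r) →
      transduce (Body , zero) ((c ∷ enc φ ++ enc ψ) ++ r) ≡
        replicate (length (map complement (indices φ ++ indices ψ))) sA ++ transduce (Body , zero) r
    pass₀-body₂ c φ ψ r h skip =
      begin
        transduce (Body , zero) ((c ∷ enc φ ++ enc ψ) ++ r)
      ≡⟨ trans skip (cong (transduce (Body , zero)) (++-assoc (enc φ) (enc ψ) r)) ⟩
        transduce (Body , zero) (enc φ ++ enc ψ ++ r)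
      ≡⟨ pass₀-body φ (enc ψ ++ r) (enc-NoLeadingI ψ r) ⟩
        replicate (length (constraints φ)) sA ++ transduce (Body , zero) (enc ψ ++ r)
      ≡⟨ cong (replicate (length (constraints φ)) sA ++_) (pass₀-body ψ r h) ⟩
        replicate (length (constraints φ)) sA ++ replicate (length (constraints ψ)) sA ++ transduce (Body , zero) r
      ≡⟨ sym (++-assoc (replicate (length (constraints φ)) sA) _ _) ⟩
        (replicate (length (constraints φ)) sA ++ replicate (length (constraints ψ)) sA) ++ transduce (Body , zero) r
      ≡⟨ cong (_++ transduce (Body , zero) r) (sym (trans (cong (λ n → replicate n sA) (length-constraints φ ψ))
                                                         (replicate-+ (length (constraints φ)) (length (constraints ψ)) sA))) ⟩
        replicate (length (map complement (indices φ ++ indices ψ))) sA ++ transduce (Body , zero) r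
      ∎
      where open ≡-Reasoning
    pass₀-body (var (inj₁ k)) r h =
      trans (transduce-BodyX-tally₀ (suc k) r)
            (cong₂ (λ n l → replicate n sA ++ l) (sym (trans (length-map complement (downFrom (suc k))) (length-downFrom (suc k))))
                   (transduce-BodyX-end zero r h))
    pass₀-body (var (inj₂ j)) r h = transduce-Body-tally₀ (suc (toℕ j)) r
    pass₀-body ⊤f       r h = refl
    pass₀-body ⊥f       r h = refl
    pass₀-body (¬f φ)   r h = pass₀-body φ r h
    pass₀-body (φ ∧f ψ) r h = pass₀-body₂ sA φ ψ r h refl
    pass₀-body (φ ∨f ψ) r h = pass₀-body₂ sO φ ψ r h refl
    pass₀-body (φ ⇒f ψ) r h = pass₀-body₂ sM φ ψ r h refl

    pass₁-body : ∀ φ r → NoLeadingI r → transduce (Body , suc zero) (enc φ ++ r)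
      ≡ enc (rename shift φ) ++ transduce (Body , suc zero) r
    pass₁-body₂ : ∀ c φ ψ r → NoLeadingI r →
      (c ∷ transduce (Body , suc zero) ((enc φ ++ enc ψ) ++ r)) ≡
        ((c ∷ enc (rename shift φ) ++ enc (rename shift ψ)) ++ transduce (Body , suc zero) r)
    pass₁-body₂ c φ ψ r h = cong (c ∷_)
      (trans (cong (transduce (Body , suc zero)) (++-assoc (enc φ) (enc ψ) r))
      (trans (pass₁-body φ (enc ψ ++ r) (enc-NoLeadingI ψ r))
      (trans (cong (enc (rename shift φ) ++_) (pass₁-body ψ r h)) (sym (++-assoc (enc (rename shift φ)) _ _)))))
    pass₁-body (var (inj₁ k)) r h =
      cong (sX ∷_) (trans (transduce-BodyX-tally₁ (suc k) r)
                          (cong (replicate (double (suc k)) sI ++_) (transduce-BodyX-end (suc zero) r h)))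
    pass₁-body (var (inj₂ j)) r h = cong (sY ∷_) (transduce-Body-tally₁ (suc (toℕ j)) r)
    pass₁-body ⊤f       r h = refl
    pass₁-body ⊥f       r h = refl
    pass₁-body (¬f φ)   r h = cong (sN ∷_) (pass₁-body φ r h)
    pass₁-body (φ ∧f ψ) r h = pass₁-body₂ sA φ ψ r h
    pass₁-body (φ ∨f ψ) r h = pass₁-body₂ sO φ ψ r h
    pass₁-body (φ ⇒f ψ) r h = pass₁-body₂ sM φ ψ r h

    transduce-Prefix-tally₀ : ∀ n X → transduce (Prefix , zero) (replicate n sI ++ X)
      ≡ replicate n sI ++ transduce (Prefix , zero) X
    transduce-Prefix-tally₀ zero    X = refl
    transduce-Prefix-tally₀ (suc n) X = cong (sI ∷_) (transduce-Prefix-tally₀ n X)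

    transduce-Prefix-tally₁ : ∀ n X → transduce (Prefix , suc zero) (replicate n sI ++ X) ≡ transduce (Prefix , suc zero) X
    transduce-Prefix-tally₁ zero    X = refl
    transduce-Prefix-tally₁ (suc n) X = transduce-Prefix-tally₁ n X

    transduce-Prefix-body : ∀ p φ r → transduce (Prefix , p) (enc φ ++ r) ≡ transduce (Body , p) (enc φ ++ r)
    transduce-Prefix-body p (var (inj₁ _)) r = refl
    transduce-Prefix-body p (var (inj₂ _)) r = refl
    transduce-Prefix-body p ⊤f             r = refl
    transduce-Prefix-body p ⊥f             r = refl
    transduce-Prefix-body p (¬f _)         r = refl
    transduce-Prefix-body p (_ ∧f _)       r = refl
    transduce-Prefix-body p (_ ∨f _)       r = refl
    transduce-Prefix-body p (_ ⇒f _)       r = refl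

    pass₀-binders : ∀ (f : ℕ → ℕ) n φ r →
      transduce (Prefix , zero) (concatMap binder (applyUpTo f n) ++ (enc φ ++ r)) ≡
        concatMap binder (applyUpTo f n) ++ transduce (Body , zero) (enc φ ++ r)
    pass₀-binders f zero    φ r = transduce-Prefix-body zero φ r
    pass₀-binders f (suc n) φ r =
      trans (cong (transduce (Prefix , zero)) (++-assoc (binder (f zero)) Rest (enc φ ++ r)))
      (cong (λ l → sE ∷ sY ∷ l)
        (trans (transduce-Prefix-tally₀ (suc (f zero)) (Rest ++ enc φ ++ r))
        (trans (cong (replicate (suc (f zero)) sI ++_) (pass₀-binders (λ i → f (suc i)) n φ r))
               (sym (++-assoc (replicate (suc (f zero)) sI) Rest _)))))
      where
        Rest = concatMap binder (applyUpTo (λ i → f (suc i)) n)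

    pass₁-binders : ∀ (f : ℕ → ℕ) n φ r →
      transduce (Prefix , suc zero) (concatMap binder (applyUpTo f n) ++ (enc φ ++ r)) ≡ transduce (Body , suc zero) (enc φ ++ r)
    pass₁-binders f zero    φ r = transduce-Prefix-body (suc zero) φ r
    pass₁-binders f (suc n) φ r =
      trans (cong (transduce (Prefix , suc zero)) (++-assoc (binder (f zero)) Rest (enc φ ++ r)))
      (trans (transduce-Prefix-tally₁ (suc (f zero)) (Rest ++ enc φ ++ r)) (pass₁-binders (λ i → f (suc i)) n φ r))
      where
        Rest = concatMap binder (applyUpTo (λ i → f (suc i)) n)

    enc-foldl-∧f : ∀ es ψ → enc (foldl _∧f_ ψ es) ≡ replicate (length es) sA ++ enc ψ ++ concatMap enc es
    enc-foldl-∧f []       ψ = sym (++-identityʳ (enc ψ))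
    enc-foldl-∧f (e ∷ es) ψ =
      trans (enc-foldl-∧f es (ψ ∧f e))
      (trans (As-∷ʳ (length es) ((enc ψ ++ enc e) ++ concatMap enc es))
             (cong (λ l → sA ∷ replicate (length es) sA ++ l) (++-assoc (enc ψ) (enc e) (concatMap enc es))))
      where
        As-∷ʳ : ∀ n (Z : List Sym) → replicate n sA ++ (sA ∷ Z) ≡ sA ∷ replicate n sA ++ Z
        As-∷ʳ zero    Z = refl
        As-∷ʳ (suc n) Z = cong (sA ∷_) (As-∷ʳ n Z)

    output-paired : ∀ φ → output′ Initial (binders m ++ (enc φ ++ [])) ≡ binders m ++ enc (paired φ)
    output-paired φ =
      begin
        output′ Initial u
      ≡⟨ output′-Initial u ⟩
        (t₀ ++ t₁ ++ t₂ ++ t₃) ++ output′ Neutral u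
      ≡⟨ cong₂ (λ x y → (x ++ y) ++ output′ Neutral u)
               (trans (pass₀-binders (λ i → i) m φ []) (cong (binders m ++_) (pass₀-body φ [] tt)))
               (cong₂ _++_ (trans (pass₁-binders (λ i → i) m φ []) (pass₁-body φ [] tt))
                           (cong₂ _++_ (transduce-Stop (suc (suc zero)) u) (transduce-Stop (suc (suc (suc zero))) u))) ⟩
        ((binders m ++ As ++ []) ++ (enc (rename shift φ) ++ []) ++ []) ++ output′ Neutral u
      ≡⟨ cong₂ (λ x y → ((binders m ++ x) ++ y) ++ output′ Neutral u) (++-identityʳ As)
               (trans (++-identityʳ _) (++-identityʳ _)) ⟩
        ((binders m ++ As) ++ enc (rename shift φ)) ++ output′ Neutral u
      ≡⟨ cong (((binders m ++ As) ++ enc (rename shift φ)) ++_)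
              (trans (output′-binders (λ i → i) m (enc φ ++ [])) (trans (output′-enc φ [] tt) (++-identityʳ _))) ⟩
        ((binders m ++ As) ++ enc (rename shift φ)) ++ concatMap enc (constraints φ)
      ≡⟨ trans (++-assoc (binders m ++ As) _ _) (++-assoc (binders m) As _) ⟩
        binders m ++ As ++ enc (rename shift φ) ++ concatMap enc (constraints φ)
      ≡⟨ cong (binders m ++_) (sym (enc-foldl-∧f (constraints φ) (rename shift φ))) ⟩
        binders m ++ enc (paired φ)
      ∎
      where
        open ≡-Reasoning
        u  = binders m ++ (enc φ ++ [])
        As = replicate (length (constraints φ)) sA
        t₀ = transduce (Prefix , zero) u
        t₁ = transduce (Prefix , suc zero) u
        t₂ = transduce (Stop , suc (suc zero)) u
        t₃ = transduce (Stop , suc (suc (suc zero))) u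

  kindToFin : Kind → Fin 7
  kindToFin Prefix  = zero
  kindToFin PrefixE = suc zero
  kindToFin Body    = suc (suc zero)
  kindToFin BodyX   = suc (suc (suc zero))
  kindToFin Piece   = suc (suc (suc (suc zero)))
  kindToFin PieceI  = suc (suc (suc (suc (suc zero))))
  kindToFin Stop    = suc (suc (suc (suc (suc (suc zero)))))

  kindFromFin : Fin 7 → Kind
  kindFromFin zero                                     = Prefix
  kindFromFin (suc zero)                               = PrefixE
  kindFromFin (suc (suc zero))                         = Body
  kindFromFin (suc (suc (suc zero)))                   = BodyX
  kindFromFin (suc (suc (suc (suc zero))))             = Piece
  kindFromFin (suc (suc (suc (suc (suc zero)))))       = PieceI
  kindFromFin (suc (suc (suc (suc (suc (suc zero)))))) = Stop

  kindFromFin-kindToFin : ∀ k → kindFromFin (kindToFin k) ≡ k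
  kindFromFin-kindToFin Prefix  = refl
  kindFromFin-kindToFin PrefixE = refl
  kindFromFin-kindToFin Body    = refl
  kindFromFin-kindToFin BodyX   = refl
  kindFromFin-kindToFin Piece   = refl
  kindFromFin-kindToFin PieceI  = refl
  kindFromFin-kindToFin Stop    = refl

  Kind-code : FinCode Kind
  Kind-code = retract-code kindToFin kindFromFin kindFromFin-kindToFin (Fin-code 7)

  Position-code : FinCode Position
  Position-code = retract-code (λ { Initial → inj₁ tt ; Neutral → inj₂ (inj₁ tt) ; InXTally → inj₂ (inj₂ tt) })
                               (λ { (inj₁ _) → Initial ; (inj₂ (inj₁ _)) → Neutral ; (inj₂ (inj₂ _)) → InXTally })
                               (λ { Initial → refl ; Neutral → refl ; InXTally → refl })
                               (⊤-code ⊎-code (⊤-code ⊎-code ⊤-code))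

  kindStep-bounded : ∀ k p x → length (map symCode (proj₂ (kindStep k p (decodeSym x)))) ≤ 5
  kindStep-bounded k p x =
    subst (λ k → length (map symCode (proj₂ (kindStep k p (decodeSym x)))) ≤ 5) (kindFromFin-kindToFin k)
          (checked (kindToFin k) p x)
    where
      checked : ∀ i p x → length (map symCode (proj₂ (kindStep (kindFromFin i) p (decodeSym x)))) ≤ 5
      checked = toWitness {a? = all? λ i → all? λ p → all? λ x → _ ≤? 5} tt

  pairing : MultiPass 10 10
  pairing = record
    { Outer = Position ; Inner = Inner ; outer-code = Position-code ; inner-code = Kind-code ×-code Fin-code 4
    ; outer₀ = Initial ; outerStep = λ q x → outerStep q (decodeSym x) ; innerStart = innerStart
    ; innerStep = relabelStep decodeSym symCode innerStep
    ; final = [] ; maxOut = 5 ; innerStep-bounded = λ { (k , p) x → kindStep-bounded k p x } ; final-bounded = z≤n }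

  output-pairing : ∀ m φ → MultiPassOutput.output pairing (codeEPF (∃[ m ] φ)) ≡ codeEPF (∃[ m ] Pairing.paired m φ)
  output-pairing m φ =
    trans (cong (λ l → MultiPassOutput.output pairing (map symCode (binders m ++ l))) (sym (++-identityʳ (enc φ))))
    (trans (output′-relabel outerStep innerStart innerStep [] symCode decodeSym decodeSym-symCode symCode Initial
                            (binders m ++ (enc φ ++ [])))
           (cong (map symCode) (PairingOutput.output-paired m φ)))
    where open Readability m using (enc)

open PairingTransducer using (pairing; output-pairing)

EPF-FSat≼EPF-FMinSat : LS-EPF-FSat ≼ptime LS-EPF-FMinSat
EPF-FSat≼EPF-FMinSat =
  ≼ptime-intro LS-EPF-FSat LS-EPF-FMinSat F G (multiPass-computable pairing) (transducer-computable interleaving)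
    (λ t ((∃[ m ] φ) , e) → (∃[ m ] paired m φ) , code≡ m φ e)
    (λ t _ v _ ((∃[ m ] φ) , e , mod) →
       tt , subst (FMinSat (F t)) (sym (G-pair t v)) ((∃[ m ] paired m φ) , code≡ m φ e , IsMinModelEPF-paired m φ v mod))
    (λ t _ v v′ _ _ eq → trans (sym (uninterleave-interleave v))
                               (trans (cong uninterleave (trans (sym (G-pair t v)) (trans eq (G-pair t v′))))
                                      (uninterleave-interleave v′)))
    surj
  where
    open Pairing using (paired; IsMinModelEPF-paired; IsModelEPF-paired⁻)
    open SecondComponent {10} {2} (λ y → flipBit y ∷ y ∷ []) 2 (λ _ → s≤s (s≤s z≤n))
      renaming (secondComponent to interleaving)
    F : Word 10 → Word 10
    F = MultiPassOutput.output pairing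
    G : Word 13 → Word 2
    G = Transducer.translate interleaving false
    G-pair : ∀ t w → G (pairEnc t w) ≡ interleave w
    G-pair = translate-second
    code≡ : ∀ {t} m φ → codeEPF (∃[ m ] φ) ≡ t → codeEPF (∃[ m ] paired m φ) ≡ F t
    code≡ m φ e = trans (sym (output-pairing m φ)) (cong F e)
    surj : ∀ t → EPF t → ∀ u → TA u → FMinSat (F t) u →
           Σ (Word 2) λ v → Σ (TA v) λ _ → FSat t v × G (pairEnc t v) ≡ u
    surj t ((∃[ m ] φ) , e) u _ (Ψ , eΨ , mod , _)
      with codeEPF-injective Ψ (∃[ m ] paired m φ) (trans eΨ (sym (code≡ m φ e)))
    ... | refl with IsModelEPF-paired⁻ m φ u mod
    ... | u≡ , mod′ = uninterleave u , tt , ((∃[ m ] φ) , e , mod′) , trans (G-pair t (uninterleave u)) (sym u≡)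

lemma2 : (LS-PF-MinSat ≼ptime LS-EPF-FMinSat) × (LS-EPF-FSat ≼ptime LS-EPF-FMinSat)
lemma2 = PF-MinSat≼EPF-FMinSat , EPF-FSat≼EPF-FMinSat
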